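{- Fix a positive integer $a$. Then in $\mathfrak{h}_t^1[[u,v]]$, $$S_t(\mathcal{F}(u,v))=E((v-tv-1)u)\ast H((1+tv)u).$$
   Context: Let $\mathfrak{h}_t=\mathbb{Q}[t]\langle x,y\rangle$ ($t$ a variable) be the noncommutative polynomial algebra in letters $x,y$, $\mathfrak{h}_t^1=\mathbb{Q}[t]+\mathfrak{h}_ty$, $z_k=x^{k-1}y$. The harmonic product $\ast$ on $\mathfrak{h}_t^1$ is $\mathbb{Q}[t]$-bilinear with $1\ast w=w\ast1=w$ and $z_kw_1\ast z_lw_2=z_k(w_1\ast z_lw_2)+z_l(z_kw_1\ast w_2)+z_{k+l}(w_1\ast w_2)$ for words $w_1,w_2\in\mathfrak{h}_t^1$. For $s$ a scalar or variable, $\sigma_s$ is the concatenation automorphism with $\sigma_s(x)=x$, $\sigma_s(y)=sx+y$, $S_s$ the linear map with $S_s(1)=1$, $S_s(wa)=\sigma_s(w)a$ for words $w$ and letters $a$, and $S=S_1$. For $k\geq n\geq1$, $N_{k,n}=\sum_{k_1+\cdots+k_n=k,\ k_i\geq1}z_{ak_1}\cdots z_{ak_n}$. With $u,v$ commuting formal variables: $E(u)=\sum_{j\geq0}z_a^ju^j$ (concatenation powers), $H(u)=\sum_{j\geq0}S(z_a^j)u^j$, $\mathcal{F}(u,v)=1+\sum_{k\geq n\geq1}N_{k,n}u^kv^n$. $S_t$ and $\ast$ are extended to power series coefficientwise, and $E(cu)$, $H(cu)$ mean substitution of $cu$ for $u$. -}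

module Defs where

open import Data.Nat as ℕ using (ℕ; zero; suc; _∸_; _≤?_)
open import Data.Rational as ℚ using (ℚ; 0ℚ; 1ℚ)
open import Data.List using (List; []; _∷_; [_]; _++_; map; concatMap; replicate; upTo; foldr; unsnoc; concat)
open import Data.List.Properties using (≡-dec)
open import Data.Product using (_×_; _,_)
open import Data.Maybe using (Maybe; just; nothing)
open import Relation.Binary.PropositionalEquality using (_≡_; refl)
open import Relation.Nullary using (Dec; yes; no; does)
open import Data.Bool using (Bool; true; false; if_then_else_; _∧_)

data Letter : Set where
  X Y : Letter

_≟L_ : (a b : Letter) → Dec (a ≡ b)
X ≟L X = yes refl
X ≟L Y = no λ ()
Y ≟L X = no λ ()
Y ≟L Y = yes refl

Word : Set
Word = List Letter

_≟W_ : (u w : Word) → Dec (u ≡ w)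
_≟W_ = ≡-dec _≟L_

-- Q[t] : finite formal sums  Σ q t^m   (entries (q , m))
Qt : Set
Qt = List (ℚ × ℕ)

tQ : Qt
tQ = [ (1ℚ , 1) ]

oneQ : Qt
oneQ = [ (1ℚ , 0) ]

-- h_t = Q[t]<x,y> : finite formal sums  Σ q t^m w   (entries (q , m , w))
H : Set
H = List (ℚ × ℕ × Word)

coeff : H → ℕ → Word → ℚ
coeff []                  m w = 0ℚ
coeff ((q , d , u) ∷ p)   m w =
  if does (d ℕ.≟ m) ∧ does (u ≟W w) then q ℚ.+ coeff p m w else coeff p m w

infix 4 _≈H_
_≈H_ : H → H → Set
p ≈H r = ∀ (m : ℕ) (w : Word) → coeff p m w ≡ coeff r m w

oneH : H
oneH = [ (1ℚ , 0 , []) ]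

letterH : Letter → H
letterH a = [ (1ℚ , 0 , [ a ]) ]

wordH : Word → H
wordH w = [ (1ℚ , 0 , w) ]

scaleH : ℚ → ℕ → H → H
scaleH q m = map (λ { (q' , d , w) → (q ℚ.* q' , m ℕ.+ d , w) })

scaleQt : Qt → H → H
scaleQt s p = concatMap (λ { (q , m) → scaleH q m p }) s

infixl 7 _·_
_·_ : H → H → H
p · r = concatMap (λ { (q , m , u) → map (λ { (q' , m' , w) → (q ℚ.* q' , m ℕ.+ m' , u ++ w) }) r }) p

powH : H → ℕ → H
powH p zero    = oneH
powH p (suc j) = p · powH p j

-- σ_s and S_s  (s ∈ Q[t]; s = 1 gives σ, S)

σ : Qt → Word → H
σ s []      = oneH
σ s (X ∷ w) = letterH X · σ s w
σ s (Y ∷ w) = (scaleQt s (letterH X) ++ letterH Y) · σ s w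

Sw : Qt → Word → H
Sw s w with unsnoc w
... | nothing       = oneH
... | just (w' , a) = σ s w' · letterH a

Sₛ : Qt → H → H
Sₛ s p = concatMap (λ { (q , m , w) → scaleH q m (Sw s w) }) p

z : ℕ → Word
z k = replicate (k ∸ 1) X ++ [ Y ]

-- a word of h^1 written as z_{k1}...z_{kn} ↦ (k1,...,kn)
-- (a trailing block of x's, which never occurs in h^1, is discarded)
parse : Word → List ℕ
parse []      = []
parse (Y ∷ w) = 1 ∷ parse w
parse (X ∷ w) with parse w
... | []     = []
... | k ∷ ks = suc k ∷ ks

zs : List ℕ → Word
zs ks = concatMap z ks

-- harmonic product of z-sequences (all resulting words with coefficient 1)
harmC : List ℕ → List ℕ → List (List ℕ)
harmC []      b       = [ b ]
harmC (k ∷ a) []      = [ k ∷ a ]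
harmC (k ∷ a) (l ∷ b) =
  map (k ∷_) (harmC a (l ∷ b)) ++ map (l ∷_) (harmC (k ∷ a) b) ++ map (k ℕ.+ l ∷_) (harmC a b)

harmW : Word → Word → H
harmW u w = map (λ ks → (1ℚ , 0 , zs ks)) (harmC (parse u) (parse w))

infixl 6 _∗_
_∗_ : H → H → H
p ∗ r = concatMap (λ { (q , m , u) → concatMap (λ { (q' , m' , w) → scaleH (q ℚ.* q') (m ℕ.+ m') (harmW u w) }) r }) p

-- Q[t][v] : finite formal sums Σ q t^m v^d   (entries (q , m , d))
QtV : Set
QtV = List (ℚ × ℕ × ℕ)

_*V_ : QtV → QtV → QtV
p *V r = concatMap (λ { (q , m , d) → map (λ { (q' , m' , d') → (q ℚ.* q' , m ℕ.+ m' , d ℕ.+ d') }) r }) p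

powV : QtV → ℕ → QtV
powV c zero    = [ (1ℚ , 0 , 0) ]
powV c (suc j) = c *V powV c j

coeffV : QtV → ℕ → Qt
coeffV []                n = []
coeffV ((q , m , d) ∷ c) n = if does (d ℕ.≟ n) then (q , m) ∷ coeffV c n else coeffV c n

-- Power series:  univariate  G(u) = Σ_j G j u^j,
--                bivariate   A(u,v) = Σ_{k,n} A k n u^k v^n

Series1 : Set
Series1 = ℕ → H

Series2 : Set
Series2 = ℕ → ℕ → H

-- G(c u) for c ∈ Q[t][v]:  coefficient of u^k v^n is [v^n](c^k) · G k
subst : Series1 → QtV → Series2
subst G c k n = scaleQt (coeffV (powV c k) n) (G k)

Sₛ² : Qt → Series2 → Series2
Sₛ² s A k n = Sₛ s (A k n)

_∗²_ : Series2 → Series2 → Series2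
(A ∗² B) k n = concatMap (λ i → concatMap (λ j → A i j ∗ B (k ∸ i) (n ∸ j)) (upTo (suc n))) (upTo (suc k))

-- compositions of k into n positive parts
comps : ℕ → ℕ → List (List ℕ)
comps zero    zero    = [ [] ]
comps (suc k) zero    = []
comps k       (suc n) = concatMap (λ i → map (suc i ∷_) (comps (k ∸ suc i) n)) (upTo k)

N : ℕ → ℕ → ℕ → H
N a k n = map (λ ks → (1ℚ , 0 , zs (map (a ℕ.*_) ks))) (comps k n)

E : ℕ → Series1
E a j = powH (wordH (z a)) j

Hs : ℕ → Series1
Hs a j = Sₛ oneQ (powH (wordH (z a)) j)

F : ℕ → Series2
F a zero    zero    = oneH
F a (suc k) zero    = []
F a k       (suc n) = if does (suc n ≤? k) then N a k (suc n) else []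

-- v - t v - 1   and   1 + t v
c₁ : QtV
c₁ = (1ℚ , 0 , 1) ∷ (ℚ.- 1ℚ , 1 , 1) ∷ (ℚ.- 1ℚ , 0 , 0) ∷ []

c₂ : QtV
c₂ = (1ℚ , 0 , 0) ∷ (1ℚ , 1 , 1) ∷ []

{-# OPTIONS --safe #-}
module Submission where

-- Both sides are compared coefficientwise in u, as polynomials in v over h_t.
-- The u^k coefficient Q_k = Σ_r v^r S_t(N_{k,r}) of the left side satisfies
--   Q_k = [k = 0] + Σ_i v z_{a(i+1)} Q_{k-i-1} + Σ_{i<k-1} tv x^{a(i+1)} Q_{k-i-1},
-- because N_{k,r+1} = Σ_i z_{a(i+1)} N_{k-i-1,r} and S_t(z_m w) = z_m S_t(w) + t x^m S_t(w) for w ≠ 1.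
-- The u^k coefficient P_k = Σ_i c₁^i c₂^{k-i} (z_a^i ∗ S(z_a^{k-i})) of the right side, where
-- c₁ = v - tv - 1 and c₂ = 1 + tv, satisfies P_k = [k = 0] + Σ_m v c₂^m z_{a(m+1)} P_{k-m-1}:
-- expand z_a^i ∗ S(z_a^l) by the recursion of ∗ and S(z_a^{l+1}) = Σ_m z_{a(m+1)} S(z_a^{l-m}),
-- and use c₁ + c₂ = v. Expanding c₂^m = (1 + tv)^m geometrically, with x^{a(i+1)} z_{a(m+1)} = z_{a(i+m+2)},
-- turns this into the first recursion, whose solution is unique.
--
-- Elements of h_t and of h_t[v] are lists of (coefficient, basis element), identified (≋) when
-- every linear functional takes the same value on them.

open import Defs
open import Data.Nat as ℕ using (ℕ; zero; suc; _∸_; _≤_; _<_; _≥_; s≤s; z≤n)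
import Data.Nat.Properties as ℕP
open import Data.Nat.Induction using (<-rec)
open import Data.Rational using (ℚ; 0ℚ; 1ℚ; _+_; _*_; -_)
import Data.Rational.Properties as ℚP
open import Data.Rational.Solver using (module +-*-Solver)
open import Data.List using (List; []; _∷_; [_]; _++_; _∷ʳ_; map; concatMap; replicate; applyUpTo; upTo; initLast; _∷ʳ′_)
import Data.List.Properties as LP
open import Data.Product using (_×_; _,_; proj₁; proj₂; ∃₂)
open import Data.Bool using (true; false; if_then_else_; _∧_)
open import Data.Unit using (⊤)
open import Data.Empty using (⊥)
open import Relation.Nullary using (does; yes; no)
open import Relation.Nullary.Decidable using (dec-true; dec-false)
open import Function using (_∘_; id)
open import Relation.Binary.PropositionalEquality
  using (_≡_; _≢_; refl; sym; trans; cong; cong₂; module ≡-Reasoning)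
  renaming (subst to ≡-subst)

open ≡-Reasoning
open +-*-Solver using (solve; _:+_; _:*_; _:=_; con)

-- Formal linear combinations

Lin : Set → Set
Lin B = List (ℚ × B)

ev : {B : Set} → (B → ℚ) → Lin B → ℚ
ev g []            = 0ℚ
ev g ((q , b) ∷ p) = q * g b + ev g p

infix 4 _≋_
record _≋_ {B : Set} (p r : Lin B) : Set where
  constructor mk≋
  field ev-≡ : ∀ g → ev g p ≡ ev g r
open _≋_ public

≋-refl : {B : Set} {p : Lin B} → p ≋ p
≋-refl = mk≋ λ _ → refl

≋-sym : {B : Set} {p r : Lin B} → p ≋ r → r ≋ p
≋-sym e = mk≋ λ g → sym (ev-≡ e g)

≋-trans : {B : Set} {p r s : Lin B} → p ≋ r → r ≋ s → p ≋ s
≋-trans e f = mk≋ λ g → trans (ev-≡ e g) (ev-≡ f g)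

≡⇒≋ : {B : Set} {p r : Lin B} → p ≡ r → p ≋ r
≡⇒≋ refl = ≋-refl

module ≋-Reasoning {B : Set} where
  infix  1 begin≋_
  infixr 2 _≋⟨_⟩_ _≡⟨_⟩≋_
  infix  3 _∎≋
  begin≋_ : {p r : Lin B} → p ≋ r → p ≋ r
  begin≋ e = e
  _≋⟨_⟩_ : (p : Lin B) {r s : Lin B} → p ≋ r → r ≋ s → p ≋ s
  p ≋⟨ e ⟩ f = ≋-trans e f
  _≡⟨_⟩≋_ : (p : Lin B) {r s : Lin B} → p ≡ r → r ≋ s → p ≋ s
  p ≡⟨ refl ⟩≋ f = f
  _∎≋ : (p : Lin B) → p ≋ p
  p ∎≋ = ≋-refl

ev-cong : {B : Set} {g h : B → ℚ} (p : Lin B) → (∀ b → g b ≡ h b) → ev g p ≡ ev h p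
ev-cong []            e = refl
ev-cong ((q , b) ∷ p) e = cong₂ (λ x y → q * x + y) (e b) (ev-cong p e)

ev-++ : {B : Set} (g : B → ℚ) (p r : Lin B) → ev g (p ++ r) ≡ ev g p + ev g r
ev-++ g []            r = sym (ℚP.+-identityˡ _)
ev-++ g ((q , b) ∷ p) r = begin
  q * g b + ev g (p ++ r)        ≡⟨ cong (q * g b +_) (ev-++ g p r) ⟩
  q * g b + (ev g p + ev g r)    ≡⟨ ℚP.+-assoc (q * g b) (ev g p) (ev g r) ⟨
  q * g b + ev g p + ev g r      ∎

ev-zero : {B : Set} (p : Lin B) → ev (λ _ → 0ℚ) p ≡ 0ℚ
ev-zero []            = refl
ev-zero ((q , b) ∷ p) rewrite ev-zero p | ℚP.*-zeroʳ q = refl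

ev-+ : {B : Set} (g h : B → ℚ) (p : Lin B) → ev (λ b → g b + h b) p ≡ ev g p + ev h p
ev-+ g h []            = refl
ev-+ g h ((q , b) ∷ p) rewrite ev-+ g h p =
  solve 5 (λ q x y U V → q :* (x :+ y) :+ (U :+ V) := q :* x :+ U :+ (q :* y :+ V))
        refl q (g b) (h b) (ev g p) (ev h p)

ev²-+ : {B C : Set} (f h : B → C → ℚ) (p : Lin B) (r : Lin C) →
  ev (λ b → ev (λ c → f b c + h b c) r) p ≡ ev (λ b → ev (f b) r) p + ev (λ b → ev (h b) r) p
ev²-+ f h p r = trans (ev-cong p (λ b → ev-+ (f b) (h b) r)) (ev-+ _ _ p)

ev-* : {B : Set} (c : ℚ) (g : B → ℚ) (p : Lin B) → ev (λ b → c * g b) p ≡ c * ev g p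
ev-* c g []            = sym (ℚP.*-zeroʳ c)
ev-* c g ((q , b) ∷ p) rewrite ev-* c g p =
  solve 4 (λ c q x Z → q :* (c :* x) :+ c :* Z := c :* (q :* x :+ Z)) refl c q (g b) (ev g p)

ev-comm : {B C : Set} (f : B → C → ℚ) (p : Lin B) (r : Lin C) →
  ev (λ b → ev (f b) r) p ≡ ev (λ c → ev (λ b → f b c) p) r
ev-comm f []            r = sym (ev-zero r)
ev-comm f ((q , b) ∷ p) r = begin
  q * ev (f b) r + ev (λ b → ev (f b) r) p
    ≡⟨ cong₂ _+_ (sym (ev-* q (f b) r)) (ev-comm f p r) ⟩
  ev (λ c → q * f b c) r + ev (λ c → ev (λ b → f b c) p) r
    ≡⟨ ev-+ _ _ r ⟨
  ev (λ c → q * f b c + ev (λ b → f b c) p) r ∎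

++-comm-≋ : {B : Set} (p r : Lin B) → p ++ r ≋ r ++ p
++-comm-≋ p r = mk≋ λ g → trans (ev-++ g p r) (trans (ℚP.+-comm (ev g p) (ev g r)) (sym (ev-++ g r p)))

++-identityʳ-≋ : {B : Set} (p : Lin B) → p ++ [] ≋ p
++-identityʳ-≋ p = ≡⇒≋ (LP.++-identityʳ p)

++-cong : {B : Set} {p p' r r' : Lin B} → p ≋ p' → r ≋ r' → p ++ r ≋ p' ++ r'
++-cong {p = p} {p'} {r} {r'} e f = mk≋ λ g →
  trans (ev-++ g p r) (trans (cong₂ _+_ (ev-≡ e g) (ev-≡ f g)) (sym (ev-++ g p' r')))

++-assoc-≋ : {B : Set} (p q r : Lin B) → (p ++ q) ++ r ≋ p ++ (q ++ r)
++-assoc-≋ p q r = ≡⇒≋ (LP.++-assoc p q r)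

++-swapʳ-≋ : {B : Set} (p q r : Lin B) → (p ++ q) ++ r ≋ (p ++ r) ++ q
++-swapʳ-≋ p q r = ≋-trans (++-assoc-≋ p q r) (≋-trans (++-cong (≋-refl {p = p}) (++-comm-≋ q r)) (≋-sym (++-assoc-≋ p r q)))

++-congʳ : {B : Set} (p : Lin B) {r r' : Lin B} → r ≋ r' → p ++ r ≋ p ++ r'
++-congʳ p = ++-cong (≋-refl {p = p})

++-congˡ : {B : Set} (r : Lin B) {p p' : Lin B} → p ≋ p' → p ++ r ≋ p' ++ r
++-congˡ r e = ++-cong e (≋-refl {p = r})

record Linear {B C : Set} (F : Lin B → Lin C) : Set where
  field
    dual    : (C → ℚ) → B → ℚ
    ev-dual : ∀ g p → ev g (F p) ≡ ev (dual g) p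
open Linear public

module _ {B C : Set} {F : Lin B → Lin C} (L : Linear F) where

  linear-cong : {p p' : Lin B} → p ≋ p' → F p ≋ F p'
  linear-cong {p} {p'} e = mk≋ λ g → trans (ev-dual L g p) (trans (ev-≡ e _) (sym (ev-dual L g p')))

  linear-++ : (p r : Lin B) → F (p ++ r) ≋ F p ++ F r
  linear-++ p r = mk≋ λ g → begin
    ev g (F (p ++ r))             ≡⟨ ev-dual L g (p ++ r) ⟩
    ev (dual L g) (p ++ r)        ≡⟨ ev-++ _ p r ⟩
    ev (dual L g) p + ev (dual L g) r ≡⟨ cong₂ _+_ (ev-dual L g p) (ev-dual L g r) ⟨
    ev g (F p) + ev g (F r)       ≡⟨ ev-++ g (F p) (F r) ⟨
    ev g (F p ++ F r)             ∎

  linear-[] : F [] ≋ []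
  linear-[] = mk≋ λ g → ev-dual L g []

linear-∘ : {B C D : Set} {F : Lin C → Lin D} {G : Lin B → Lin C} → Linear F → Linear G → Linear (F ∘ G)
linear-∘ {F = F} {G} LF LG = record
  { dual = dual LG ∘ dual LF ; ev-dual = λ g p → trans (ev-dual LF g (G p)) (ev-dual LG (dual LF g) p) }

mapBasis : {B C : Set} → (B → C) → Lin B → Lin C
mapBasis φ = map λ { (q , b) → (q , φ b) }

ev-mapBasis : {B C : Set} (g : C → ℚ) (φ : B → C) (p : Lin B) → ev g (mapBasis φ p) ≡ ev (g ∘ φ) p
ev-mapBasis g φ []            = refl
ev-mapBasis g φ ((q , b) ∷ p) = cong (q * g (φ b) +_) (ev-mapBasis g φ p)

mapBasis-linear : {B C : Set} (φ : B → C) → Linear (mapBasis φ)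
mapBasis-linear φ = record { dual = _∘ φ ; ev-dual = λ g → ev-mapBasis g φ }

mapBasis-∘ : {B C D : Set} (φ : C → D) (ψ : B → C) (p : Lin B) →
  mapBasis φ (mapBasis ψ p) ≋ mapBasis (φ ∘ ψ) p
mapBasis-∘ φ ψ p = mk≋ λ g →
  trans (ev-mapBasis g φ (mapBasis ψ p)) (trans (ev-mapBasis (g ∘ φ) ψ p) (sym (ev-mapBasis g (φ ∘ ψ) p)))

mapBasis-ext : {B C : Set} {φ ψ : B → C} → (∀ b → φ b ≡ ψ b) → (p : Lin B) → mapBasis φ p ≋ mapBasis ψ p
mapBasis-ext {φ = φ} {ψ} e p = mk≋ λ g →
  trans (ev-mapBasis g φ p) (trans (ev-cong p (cong g ∘ e)) (sym (ev-mapBasis g ψ p)))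

mapBasis-id : {B : Set} (p : Lin B) → mapBasis id p ≋ p
mapBasis-id p = ≡⇒≋ (LP.map-id p)

scaleMap : {C D : Set} → ℚ → (C → D) → Lin C → Lin D
scaleMap q φ = map λ { (q' , c) → (q * q' , φ c) }

ev-scaleMap : {C D : Set} (g : D → ℚ) (q : ℚ) (φ : C → D) (r : Lin C) →
  ev g (scaleMap q φ r) ≡ q * ev (g ∘ φ) r
ev-scaleMap g q φ []             = sym (ℚP.*-zeroʳ q)
ev-scaleMap g q φ ((q' , c) ∷ r) rewrite ev-scaleMap g q φ r =
  solve 4 (λ q q' x Z → q :* q' :* x :+ q :* Z := q :* (q' :* x :+ Z)) refl q q' (g (φ c)) (ev (g ∘ φ) r)

scaleMap-linear : {C D : Set} (q : ℚ) (φ : C → D) → Linear (scaleMap q φ)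
scaleMap-linear q φ = record
  { dual = λ g c → q * g (φ c) ; ev-dual = λ g r → trans (ev-scaleMap g q φ r) (sym (ev-* q (g ∘ φ) r)) }

extend : {B C D : Set} → (B → Lin C) → (B → C → D) → Lin B → Lin D
extend φ ψ = concatMap λ { (q , b) → scaleMap q (ψ b) (φ b) }

ev-extend : {B C D : Set} (g : D → ℚ) (φ : B → Lin C) (ψ : B → C → D) (p : Lin B) →
  ev g (extend φ ψ p) ≡ ev (λ b → ev (g ∘ ψ b) (φ b)) p
ev-extend g φ ψ []            = refl
ev-extend g φ ψ ((q , b) ∷ p) =
  trans (ev-++ g (scaleMap q (ψ b) (φ b)) _) (cong₂ _+_ (ev-scaleMap g q (ψ b) (φ b)) (ev-extend g φ ψ p))

extend-linear : {B C D : Set} (φ : B → Lin C) (ψ : B → C → D) → Linear (extend φ ψ)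
extend-linear φ ψ = record { dual = λ g b → ev (g ∘ ψ b) (φ b) ; ev-dual = λ g → ev-extend g φ ψ }

convolve : {B C D : Set} → (B → C → D) → Lin B → Lin C → Lin D
convolve f p r = extend (λ _ → r) f p

ev-convolve : {B C D : Set} (g : D → ℚ) (f : B → C → D) (p : Lin B) (r : Lin C) →
  ev g (convolve f p r) ≡ ev (λ b → ev (λ c → g (f b c)) r) p
ev-convolve g f p r = ev-extend g (λ _ → r) f p

module _ {B C D : Set} (f : B → C → D) where

  convolve-linearˡ : (r : Lin C) → Linear (λ p → convolve f p r)
  convolve-linearˡ r = record { dual = λ g b → ev (λ c → g (f b c)) r ; ev-dual = λ g p → ev-convolve g f p r }

  convolve-linearʳ : (p : Lin B) → Linear (convolve f p)
  convolve-linearʳ p = record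
    { dual = λ g c → ev (λ b → g (f b c)) p
    ; ev-dual = λ g r → trans (ev-convolve g f p r) (ev-comm _ p r) }

convolve-assoc : {A B C D E F : Set} {f : D → C → F} {g : A → B → D} {h : A → E → F} {k : B → C → E} →
  (∀ a b c → f (g a b) c ≡ h a (k b c)) → (p : Lin A) (q : Lin B) (r : Lin C) →
  convolve f (convolve g p q) r ≋ convolve h p (convolve k q r)
convolve-assoc {f = f} {g} {h} {k} e p q r = mk≋ λ γ → begin
  ev γ (convolve f (convolve g p q) r)                          ≡⟨ ev-convolve γ f (convolve g p q) r ⟩
  ev (λ d → ev (λ c → γ (f d c)) r) (convolve g p q)            ≡⟨ ev-convolve (λ d → ev (λ c → γ (f d c)) r) g p q ⟩
  ev (λ a → ev (λ b → ev (λ c → γ (f (g a b) c)) r) q) p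
    ≡⟨ ev-cong p (λ a → ev-cong q (λ b → ev-cong r (λ c → cong γ (e a b c)))) ⟩
  ev (λ a → ev (λ b → ev (λ c → γ (h a (k b c))) r) q) p        ≡⟨ ev-cong p (λ a → ev-convolve (λ x → γ (h a x)) k q r) ⟨
  ev (λ a → ev (λ x → γ (h a x)) (convolve k q r)) p            ≡⟨ ev-convolve γ h p (convolve k q r) ⟨
  ev γ (convolve h p (convolve k q r))                          ∎

convolve-comm : {B C D : Set} {f : B → C → D} {f' : C → B → D} → (∀ b c → f b c ≡ f' c b) →
  (p : Lin B) (r : Lin C) → convolve f p r ≋ convolve f' r p
convolve-comm {f = f} {f'} e p r = mk≋ λ g → begin
  ev g (convolve f p r)                       ≡⟨ ev-convolve g f p r ⟩
  ev (λ b → ev (λ c → g (f b c)) r) p         ≡⟨ ev-comm _ p r ⟩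
  ev (λ c → ev (λ b → g (f b c)) p) r         ≡⟨ ev-cong r (λ c → ev-cong p (λ b → cong g (e b c))) ⟩
  ev (λ c → ev (λ b → g (f' c b)) p) r        ≡⟨ ev-convolve g f' r p ⟨
  ev g (convolve f' r p)                      ∎

convolve-mapBasisʳ : {B C C' D : Set} (f : B → C' → D) (φ : C → C') (p : Lin B) (r : Lin C) →
  convolve f p (mapBasis φ r) ≋ convolve (λ b c → f b (φ c)) p r
convolve-mapBasisʳ f φ p r = mk≋ λ g → trans (ev-convolve g f p (mapBasis φ r))
  (trans (ev-cong p (λ b → ev-mapBasis (λ c → g (f b c)) φ r)) (sym (ev-convolve g (λ b c → f b (φ c)) p r)))

mapBasis-convolve : {B C D D' : Set} (φ : D → D') (f : B → C → D) (p : Lin B) (r : Lin C) →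
  mapBasis φ (convolve f p r) ≋ convolve (λ b c → φ (f b c)) p r
mapBasis-convolve φ f p r = mk≋ λ g → trans (ev-mapBasis g φ (convolve f p r))
  (trans (ev-convolve (g ∘ φ) f p r) (sym (ev-convolve g (λ b c → φ (f b c)) p r)))

convolve-unitˡ : {B C D : Set} (f : B → C → D) (b : B) (r : Lin C) →
  convolve f ((1ℚ , b) ∷ []) r ≋ mapBasis (f b) r
convolve-unitˡ f b r = mk≋ λ g → trans (ev-convolve g f ((1ℚ , b) ∷ []) r)
  (trans (ℚP.+-identityʳ _) (trans (ℚP.*-identityˡ _) (sym (ev-mapBasis g (f b) r))))

∸-split : (k a b : ℕ) → a ℕ.+ b ≤ k → k ∸ b ≡ a ℕ.+ (k ∸ a ∸ b)
∸-split k a b a+b≤k = begin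
  k ∸ b                    ≡⟨ cong (_∸ b) k≡ ⟨
  a ℕ.+ j ℕ.+ b ∸ b        ≡⟨ ℕP.m+n∸n≡m (a ℕ.+ j) b ⟩
  a ℕ.+ j                  ≡⟨ cong (a ℕ.+_) (ℕP.∸-+-assoc k a b) ⟨
  a ℕ.+ (k ∸ a ∸ b)        ∎
  where
  j = k ∸ (a ℕ.+ b)
  k≡ : a ℕ.+ j ℕ.+ b ≡ k
  k≡ = trans (ℕP.+-assoc a j b) (trans (cong (a ℕ.+_) (ℕP.+-comm j b))
         (trans (sym (ℕP.+-assoc a b j)) (ℕP.m+[n∸m]≡n a+b≤k)))

∸-comm : (k a b : ℕ) → k ∸ a ∸ b ≡ k ∸ b ∸ a
∸-comm k a b = trans (ℕP.∸-+-assoc k a b) (trans (cong (k ∸_) (ℕP.+-comm a b)) (sym (ℕP.∸-+-assoc k b a)))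

∑ : ℕ → (ℕ → ℚ) → ℚ
∑ zero    f = 0ℚ
∑ (suc n) f = f 0 + ∑ n (f ∘ suc)

⨁ : {A : Set} → ℕ → (ℕ → List A) → List A
⨁ zero    f = []
⨁ (suc n) f = f 0 ++ ⨁ n (f ∘ suc)

concatMap-applyUpTo : {A B : Set} (f : A → List B) (h : ℕ → A) (n : ℕ) →
  concatMap f (applyUpTo h n) ≡ ⨁ n (f ∘ h)
concatMap-applyUpTo f h zero    = refl
concatMap-applyUpTo f h (suc n) = cong (f (h 0) ++_) (concatMap-applyUpTo f (h ∘ suc) n)

ev-⨁ : {B : Set} (g : B → ℚ) (n : ℕ) (f : ℕ → Lin B) → ev g (⨁ n f) ≡ ∑ n (λ i → ev g (f i))
ev-⨁ g zero    f = refl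
ev-⨁ g (suc n) f = trans (ev-++ g (f 0) _) (cong (ev g (f 0) +_) (ev-⨁ g n (f ∘ suc)))

∑-cong< : (n : ℕ) {f g : ℕ → ℚ} → (∀ i → i < n → f i ≡ g i) → ∑ n f ≡ ∑ n g
∑-cong< zero    e = refl
∑-cong< (suc n) e = cong₂ _+_ (e 0 (s≤s z≤n)) (∑-cong< n (λ i i<n → e (suc i) (s≤s i<n)))

∑-cong : (n : ℕ) {f g : ℕ → ℚ} → (∀ i → f i ≡ g i) → ∑ n f ≡ ∑ n g
∑-cong n e = ∑-cong< n (λ i _ → e i)

∑-zero : (n : ℕ) → ∑ n (λ _ → 0ℚ) ≡ 0ℚ
∑-zero zero    = refl
∑-zero (suc n) rewrite ∑-zero n = refl

∑-+ : (n : ℕ) (f g : ℕ → ℚ) → ∑ n (λ i → f i + g i) ≡ ∑ n f + ∑ n g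
∑-+ zero    f g = refl
∑-+ (suc n) f g rewrite ∑-+ n (f ∘ suc) (g ∘ suc) =
  solve 4 (λ a b c d → (a :+ b) :+ (c :+ d) := (a :+ c) :+ (b :+ d)) refl (f 0) (g 0) (∑ n (f ∘ suc)) (∑ n (g ∘ suc))

∑-snoc : (n : ℕ) (f : ℕ → ℚ) → ∑ (suc n) f ≡ ∑ n f + f n
∑-snoc zero    f = trans (ℚP.+-identityʳ (f 0)) (sym (ℚP.+-identityˡ (f 0)))
∑-snoc (suc n) f rewrite ∑-snoc n (f ∘ suc) = sym (ℚP.+-assoc (f 0) _ _)

ev-∑ : {B : Set} (n : ℕ) (f : ℕ → B → ℚ) (p : Lin B) → ev (λ b → ∑ n (λ i → f i b)) p ≡ ∑ n (λ i → ev (f i) p)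
ev-∑ zero    f p = ev-zero p
ev-∑ (suc n) f p = trans (ev-+ (f 0) _ p) (cong (ev (f 0) p +_) (ev-∑ n (f ∘ suc) p))

∑-comm : (n m : ℕ) (f : ℕ → ℕ → ℚ) → ∑ n (λ i → ∑ m (f i)) ≡ ∑ m (λ j → ∑ n (λ i → f i j))
∑-comm zero    m f = sym (∑-zero m)
∑-comm (suc n) m f = trans (cong (∑ m (f 0) +_) (∑-comm n m (f ∘ suc))) (sym (∑-+ m (f 0) _))

∑-split : (k n : ℕ) (f : ℕ → ℚ) → ∑ (k ℕ.+ n) f ≡ ∑ k f + ∑ n (λ i → f (k ℕ.+ i))
∑-split zero    n f = sym (ℚP.+-identityˡ _)
∑-split (suc k) n f rewrite ∑-split k n (f ∘ suc) = sym (ℚP.+-assoc (f 0) _ _)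

∑-vanishing-tail : (m n : ℕ) (f : ℕ → ℚ) → m ≤ n → (∀ i → m ≤ i → f i ≡ 0ℚ) → ∑ n f ≡ ∑ m f
∑-vanishing-tail m n f m≤n vanish = begin
  ∑ n f                                          ≡⟨ cong (λ x → ∑ x f) (ℕP.m+[n∸m]≡n m≤n) ⟨
  ∑ (m ℕ.+ (n ∸ m)) f                            ≡⟨ ∑-split m (n ∸ m) f ⟩
  ∑ m f + ∑ (n ∸ m) (λ i → f (m ℕ.+ i))
    ≡⟨ cong (∑ m f +_) (trans (∑-cong (n ∸ m) (λ i → vanish (m ℕ.+ i) (ℕP.m≤m+n m i))) (∑-zero (n ∸ m))) ⟩
  ∑ m f + 0ℚ                                     ≡⟨ ℚP.+-identityʳ _ ⟩
  ∑ m f                                          ∎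

-- Both sides sum f i m over i + m < n.
∑-triangle-comm : (n : ℕ) (f : ℕ → ℕ → ℚ) →
  ∑ n (λ i → ∑ (n ∸ suc i) (f i)) ≡ ∑ n (λ m → ∑ (n ∸ suc m) (λ i → f i m))
∑-triangle-comm zero    f = refl
∑-triangle-comm (suc n) f = begin
  ∑ n (f 0) + ∑ n (λ i → ∑ (n ∸ suc i) (f (suc i)))
    ≡⟨ cong (∑ n (f 0) +_) (∑-triangle-comm n (f ∘ suc)) ⟩
  ∑ n (f 0) + ∑ n (λ m → ∑ (n ∸ suc m) (λ i → f (suc i) m))
    ≡⟨ ∑-+ n (f 0) _ ⟨
  ∑ n (λ m → f 0 m + ∑ (n ∸ suc m) (λ i → f (suc i) m))
    ≡⟨ ∑-cong< n (λ m m<n → cong (λ x → ∑ x (λ i → f i m)) (sym (ℕP.+-∸-assoc 1 m<n))) ⟩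
  ∑ n (λ m → ∑ (suc n ∸ suc m) (λ i → f i m))
    ≡⟨ ℚP.+-identityʳ _ ⟨
  ∑ n (λ m → ∑ (suc n ∸ suc m) (λ i → f i m)) + 0ℚ
    ≡⟨ cong (λ x → ∑ n (λ m → ∑ (suc n ∸ suc m) (λ i → f i m)) + ∑ x (λ i → f i n)) (ℕP.n∸n≡0 n) ⟨
  ∑ n (λ m → ∑ (suc n ∸ suc m) (λ i → f i m)) + ∑ (suc n ∸ suc n) (λ i → f i n)
    ≡⟨ ∑-snoc n (λ m → ∑ (suc n ∸ suc m) (λ i → f i m)) ⟨
  ∑ (suc n) (λ m → ∑ (suc n ∸ suc m) (λ i → f i m)) ∎

-- Both sides sum f c m over c + m < n, the right one grouped by s = c + m.
∑-triangle-antidiagonal : (n : ℕ) (f : ℕ → ℕ → ℚ) →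
  ∑ n (λ c → ∑ (n ∸ c) (f c)) ≡ ∑ n (λ s → ∑ (suc s) (λ c → f c (s ∸ c)))
∑-triangle-antidiagonal zero    f = refl
∑-triangle-antidiagonal (suc n) f = begin
  ∑ (suc n) (f 0) + ∑ n (λ c → ∑ (n ∸ c) (f (suc c)))
    ≡⟨ cong (∑ (suc n) (f 0) +_) (∑-triangle-antidiagonal n (f ∘ suc)) ⟩
  ∑ (suc n) (f 0) + ∑ n (λ s → ∑ (suc s) (λ c → f (suc c) (s ∸ c)))
    ≡⟨ cong (∑ (suc n) (f 0) +_) (ℚP.+-identityˡ _) ⟨
  ∑ (suc n) (f 0) + (0ℚ + ∑ n (λ s → ∑ (suc s) (λ c → f (suc c) (s ∸ c))))
    ≡⟨ ∑-+ (suc n) (f 0) (λ s → ∑ s (λ c → f (suc c) (s ∸ suc c))) ⟨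
  ∑ (suc n) (λ s → f 0 s + ∑ s (λ c → f (suc c) (s ∸ suc c))) ∎

⨁-cong< : {B : Set} (n : ℕ) {f f' : ℕ → Lin B} → (∀ i → i < n → f i ≋ f' i) → ⨁ n f ≋ ⨁ n f'
⨁-cong< zero    e = ≋-refl
⨁-cong< (suc n) e = ++-cong (e 0 (s≤s z≤n)) (⨁-cong< n (λ i i<n → e (suc i) (s≤s i<n)))

⨁-cong : {B : Set} (n : ℕ) {f f' : ℕ → Lin B} → (∀ i → f i ≋ f' i) → ⨁ n f ≋ ⨁ n f'
⨁-cong n e = ⨁-cong< n (λ i _ → e i)

⨁-≡[] : {A : Set} (n : ℕ) (f : ℕ → List A) → (∀ i → i < n → f i ≡ []) → ⨁ n f ≡ []
⨁-≡[] zero    f e = refl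
⨁-≡[] (suc n) f e rewrite e 0 (s≤s z≤n) = ⨁-≡[] n (f ∘ suc) (λ i i<n → e (suc i) (s≤s i<n))

⨁-cong-≡ : {A : Set} (n : ℕ) {f f' : ℕ → List A} → (∀ i → f i ≡ f' i) → ⨁ n f ≡ ⨁ n f'
⨁-cong-≡ zero    e = refl
⨁-cong-≡ (suc n) e = cong₂ _++_ (e 0) (⨁-cong-≡ n (e ∘ suc))

map-⨁ : {A B : Set} (φ : A → B) (n : ℕ) (f : ℕ → List A) → map φ (⨁ n f) ≡ ⨁ n (map φ ∘ f)
map-⨁ φ zero    f = refl
map-⨁ φ (suc n) f = trans (LP.map-++ φ (f 0) _) (cong (map φ (f 0) ++_) (map-⨁ φ n (f ∘ suc)))

linear-⨁ : {B C : Set} {F : Lin B → Lin C} → Linear F → (n : ℕ) (f : ℕ → Lin B) → F (⨁ n f) ≋ ⨁ n (F ∘ f)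
linear-⨁ L zero    f = linear-[] L
linear-⨁ L (suc n) f = ≋-trans (linear-++ L (f 0) _) (++-cong ≋-refl (linear-⨁ L n (f ∘ suc)))

⨁-++ : {B : Set} (n : ℕ) (f g : ℕ → Lin B) → ⨁ n (λ i → f i ++ g i) ≋ ⨁ n f ++ ⨁ n g
⨁-++ n f g = mk≋ λ h → begin
  ev h (⨁ n (λ i → f i ++ g i))               ≡⟨ ev-⨁ h n _ ⟩
  ∑ n (λ i → ev h (f i ++ g i))               ≡⟨ ∑-cong n (λ i → ev-++ h (f i) (g i)) ⟩
  ∑ n (λ i → ev h (f i) + ev h (g i))         ≡⟨ ∑-+ n _ _ ⟩
  ∑ n (λ i → ev h (f i)) + ∑ n (λ i → ev h (g i)) ≡⟨ cong₂ _+_ (ev-⨁ h n f) (ev-⨁ h n g) ⟨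
  ev h (⨁ n f) + ev h (⨁ n g)                 ≡⟨ ev-++ h (⨁ n f) (⨁ n g) ⟨
  ev h (⨁ n f ++ ⨁ n g)                       ∎

⨁-snoc : {B : Set} (n : ℕ) (f : ℕ → Lin B) → ⨁ (suc n) f ≋ ⨁ n f ++ f n
⨁-snoc n f = mk≋ λ h → begin
  ev h (⨁ (suc n) f)                   ≡⟨ ev-⨁ h (suc n) f ⟩
  ∑ (suc n) (λ i → ev h (f i))         ≡⟨ ∑-snoc n _ ⟩
  ∑ n (λ i → ev h (f i)) + ev h (f n)  ≡⟨ cong (_+ ev h (f n)) (ev-⨁ h n f) ⟨
  ev h (⨁ n f) + ev h (f n)            ≡⟨ ev-++ h (⨁ n f) (f n) ⟨
  ev h (⨁ n f ++ f n)                  ∎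

⨁-comm : {B : Set} (n m : ℕ) (f : ℕ → ℕ → Lin B) → ⨁ n (λ i → ⨁ m (f i)) ≋ ⨁ m (λ j → ⨁ n (λ i → f i j))
⨁-comm n m f = mk≋ λ h → begin
  ev h (⨁ n (λ i → ⨁ m (f i)))                ≡⟨ ev-⨁ h n _ ⟩
  ∑ n (λ i → ev h (⨁ m (f i)))                ≡⟨ ∑-cong n (λ i → ev-⨁ h m (f i)) ⟩
  ∑ n (λ i → ∑ m (λ j → ev h (f i j)))        ≡⟨ ∑-comm n m _ ⟩
  ∑ m (λ j → ∑ n (λ i → ev h (f i j)))        ≡⟨ ∑-cong m (λ j → ev-⨁ h n (λ i → f i j)) ⟨
  ∑ m (λ j → ev h (⨁ n (λ i → f i j)))        ≡⟨ ev-⨁ h m _ ⟨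
  ev h (⨁ m (λ j → ⨁ n (λ i → f i j)))        ∎

⨁-vanishing : {B : Set} (n : ℕ) (f : ℕ → Lin B) → (∀ i → f i ≋ []) → ⨁ n f ≋ []
⨁-vanishing n f vanish = mk≋ λ g →
  trans (ev-⨁ g n f) (trans (∑-cong n (λ i → ev-≡ (vanish i) g)) (∑-zero n))

⨁-vanishing-tail : {B : Set} (m n : ℕ) (f : ℕ → Lin B) → m ≤ n → (∀ i → m ≤ i → f i ≋ []) → ⨁ n f ≋ ⨁ m f
⨁-vanishing-tail m n f m≤n vanish = mk≋ λ h → begin
  ev h (⨁ n f)             ≡⟨ ev-⨁ h n f ⟩
  ∑ n (λ i → ev h (f i))   ≡⟨ ∑-vanishing-tail m n _ m≤n (λ i m≤i → ev-≡ (vanish i m≤i) h) ⟩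
  ∑ m (λ i → ev h (f i))   ≡⟨ ev-⨁ h m f ⟨
  ev h (⨁ m f)             ∎

⨁-triangle-comm : {B : Set} (n : ℕ) (f : ℕ → ℕ → Lin B) →
  ⨁ n (λ i → ⨁ (n ∸ suc i) (f i)) ≋ ⨁ n (λ m → ⨁ (n ∸ suc m) (λ i → f i m))
⨁-triangle-comm n f = mk≋ λ h → begin
  ev h (⨁ n (λ i → ⨁ (n ∸ suc i) (f i)))                  ≡⟨ ev-⨁ h n _ ⟩
  ∑ n (λ i → ev h (⨁ (n ∸ suc i) (f i)))                  ≡⟨ ∑-cong n (λ i → ev-⨁ h (n ∸ suc i) (f i)) ⟩
  ∑ n (λ i → ∑ (n ∸ suc i) (λ m → ev h (f i m)))          ≡⟨ ∑-triangle-comm n (λ i m → ev h (f i m)) ⟩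
  ∑ n (λ m → ∑ (n ∸ suc m) (λ i → ev h (f i m)))          ≡⟨ ∑-cong n (λ m → ev-⨁ h (n ∸ suc m) (λ i → f i m)) ⟨
  ∑ n (λ m → ev h (⨁ (n ∸ suc m) (λ i → f i m)))          ≡⟨ ev-⨁ h n _ ⟨
  ev h (⨁ n (λ m → ⨁ (n ∸ suc m) (λ i → f i m)))          ∎

⨁-triangle-antidiagonal : {B : Set} (n : ℕ) (f : ℕ → ℕ → Lin B) →
  ⨁ n (λ c → ⨁ (n ∸ c) (f c)) ≋ ⨁ n (λ s → ⨁ (suc s) (λ c → f c (s ∸ c)))
⨁-triangle-antidiagonal n f = mk≋ λ h → begin
  ev h (⨁ n (λ c → ⨁ (n ∸ c) (f c)))                      ≡⟨ ev-⨁ h n _ ⟩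
  ∑ n (λ c → ev h (⨁ (n ∸ c) (f c)))                      ≡⟨ ∑-cong n (λ c → ev-⨁ h (n ∸ c) (f c)) ⟩
  ∑ n (λ c → ∑ (n ∸ c) (λ m → ev h (f c m)))              ≡⟨ ∑-triangle-antidiagonal n (λ c m → ev h (f c m)) ⟩
  ∑ n (λ s → ∑ (suc s) (λ c → ev h (f c (s ∸ c))))        ≡⟨ ∑-cong n (λ s → ev-⨁ h (suc s) (λ c → f c (s ∸ c))) ⟨
  ∑ n (λ s → ev h (⨁ (suc s) (λ c → f c (s ∸ c))))        ≡⟨ ev-⨁ h n _ ⟨
  ev h (⨁ n (λ s → ⨁ (suc s) (λ c → f c (s ∸ c))))        ∎

-- The algebra h_t

Monomial : Set
Monomial = ℕ × Word

_⋆_ : Monomial → Monomial → Monomial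
(m , u) ⋆ (n , w) = (m ℕ.+ n , u ++ w)

shiftT : ℕ → Monomial → Monomial
shiftT m (d , w) = (m ℕ.+ d , w)

prefixMonomial : Word → Monomial → Monomial
prefixMonomial u (m , w) = (m , u ++ w)

prefix : Word → H → H
prefix u = mapBasis (prefixMonomial u)

ev-· : (g : Monomial → ℚ) (p r : H) → ev g (p · r) ≡ ev (λ b → ev (λ c → g (b ⋆ c)) r) p
ev-· g = ev-convolve g _⋆_

·-linearʳ : (p : H) → Linear (p ·_)
·-linearʳ = convolve-linearʳ _⋆_

·-congʳ : (p : H) {r r' : H} → r ≋ r' → p · r ≋ p · r'
·-congʳ p = linear-cong (·-linearʳ p)

·-congˡ : (r : H) {p p' : H} → p ≋ p' → p · r ≋ p' · r
·-congˡ r = linear-cong (convolve-linearˡ _⋆_ r)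

·-assoc : (p r s : H) → (p · r) · s ≋ p · (r · s)
·-assoc = convolve-assoc λ { (m , u) (n , v) (k , w) → cong₂ _,_ (ℕP.+-assoc m n k) (LP.++-assoc u v w) }

wordH-· : (u : Word) (p : H) → wordH u · p ≋ prefix u p
wordH-· u = convolve-unitˡ _⋆_ (0 , u)

oneH-· : (p : H) → oneH · p ≋ p
oneH-· p = ≋-trans (wordH-· [] p) (mapBasis-id p)

·-oneH : (p : H) → p · oneH ≋ p
·-oneH p = mk≋ λ g → trans (ev-· g p oneH) (ev-cong p λ { (m , w) → trans (ℚP.+-identityʳ _)
  (trans (ℚP.*-identityˡ _) (cong g (cong₂ _,_ (ℕP.+-identityʳ m) (LP.++-identityʳ w)))) })

·-++ˡ : (p p' r : H) → (p ++ p') · r ≋ p · r ++ p' · r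
·-++ˡ p p' r = linear-++ (convolve-linearˡ _⋆_ r) p p'

prefix-linear : (u : Word) → Linear (prefix u)
prefix-linear u = mapBasis-linear _

prefix-prefix : (u w : Word) (p : H) → prefix u (prefix w p) ≋ prefix (u ++ w) p
prefix-prefix u w p = ≋-trans (mapBasis-∘ _ _ p)
  (mapBasis-ext (λ { (m , v) → cong (m ,_) (sym (LP.++-assoc u w v)) }) p)

prefix-≡ : {u u' : Word} → u ≡ u' → (p : H) → prefix u p ≋ prefix u' p
prefix-≡ refl p = ≋-refl

ev-scaleQt : (g : Monomial → ℚ) (s : Qt) (p : H) → ev g (scaleQt s p) ≡ ev (λ m → ev (g ∘ shiftT m) p) s
ev-scaleQt g = ev-convolve g shiftT

scaleQt-linear : (s : Qt) → Linear (scaleQt s)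
scaleQt-linear = convolve-linearʳ shiftT

scaleQt-linearˡ : (p : H) → Linear (λ s → scaleQt s p)
scaleQt-linearˡ = convolve-linearˡ shiftT

scaleQt-oneQ : (p : H) → scaleQt oneQ p ≋ p
scaleQt-oneQ p = ≋-trans (convolve-unitˡ shiftT 0 p) (mapBasis-id p)

scaleQt-· : (s : Qt) (p r : H) → scaleQt s p · r ≋ scaleQt s (p · r)
scaleQt-· = convolve-assoc λ { m (d , u) (n , w) → cong (_, u ++ w) (ℕP.+-assoc m d n) }

infixl 7 _*Qt_
_*Qt_ : Qt → Qt → Qt
_*Qt_ = convolve ℕ._+_

scaleQt-*Qt : (α β : Qt) (p : H) → scaleQt (α *Qt β) p ≋ scaleQt α (scaleQt β p)
scaleQt-*Qt = convolve-assoc λ { m m' (d , w) → cong (_, w) (ℕP.+-assoc m m' d) }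

prefix-scaleQt : (u : Word) (s : Qt) (p : H) → prefix u (scaleQt s p) ≋ scaleQt s (prefix u p)
prefix-scaleQt u s p = ≋-trans (mapBasis-convolve _ shiftT s p) (≋-sym (convolve-mapBasisʳ shiftT _ s p))

·-scaleMap : (p : H) (q : ℚ) (m : ℕ) (r : H) → p · scaleMap q (shiftT m) r ≋ scaleMap q (shiftT m) (p · r)
·-scaleMap p q m r = mk≋ λ g → begin
  ev g (p · scaleMap q (shiftT m) r)                               ≡⟨ ev-· g p _ ⟩
  ev (λ b → ev (λ c → g (b ⋆ c)) (scaleMap q (shiftT m) r)) p      ≡⟨ ev-cong p (λ b → ev-scaleMap _ q (shiftT m) r) ⟩
  ev (λ b → q * ev (λ c → g (b ⋆ shiftT m c)) r) p                 ≡⟨ ev-* q _ p ⟩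
  q * ev (λ b → ev (λ c → g (b ⋆ shiftT m c)) r) p
    ≡⟨ cong (q *_) (ev-cong p λ { (d , u) → ev-cong r λ { (n , w) → cong (λ x → g (x , u ++ w)) (swap-+ d m n) } }) ⟩
  q * ev (λ b → ev (λ c → g (shiftT m (b ⋆ c))) r) p               ≡⟨ cong (q *_) (ev-· (g ∘ shiftT m) p r) ⟨
  q * ev (g ∘ shiftT m) (p · r)                                    ≡⟨ ev-scaleMap g q (shiftT m) (p · r) ⟨
  ev g (scaleMap q (shiftT m) (p · r))                             ∎
  where
  swap-+ : (d m n : ℕ) → d ℕ.+ (m ℕ.+ n) ≡ m ℕ.+ (d ℕ.+ n)
  swap-+ d m n = trans (sym (ℕP.+-assoc d m n)) (trans (cong (ℕ._+ n) (ℕP.+-comm d m)) (ℕP.+-assoc m d n))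

Sₛ-linear : (s : Qt) → Linear (Sₛ s)
Sₛ-linear s = extend-linear (λ b → Sw s (proj₂ b)) (λ b → shiftT (proj₁ b))

Sₛ-singleton : (s : Qt) (w : Word) → Sₛ s (wordH w) ≋ Sw s w
Sₛ-singleton s w = ≋-trans (++-identityʳ-≋ (scaleMap 1ℚ (shiftT 0) (Sw s w)))
  (mk≋ λ g → trans (ev-scaleMap g 1ℚ (shiftT 0) (Sw s w)) (ℚP.*-identityˡ _))

σ₁ : Qt → Letter → H
σ₁ s X = letterH X
σ₁ s Y = scaleQt s (letterH X) ++ letterH Y

σ-∷ : (s : Qt) (b : Letter) (w : Word) → σ s (b ∷ w) ≡ σ₁ s b · σ s w
σ-∷ s X w = refl
σ-∷ s Y w = refl

σ-++ : (s : Qt) (u w : Word) → σ s (u ++ w) ≋ σ s u · σ s w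
σ-++ s []      w = ≋-sym (oneH-· (σ s w))
σ-++ s (b ∷ u) w rewrite σ-∷ s b (u ++ w) | σ-∷ s b u =
  ≋-trans (·-congʳ (σ₁ s b) (σ-++ s u w)) (≋-sym (·-assoc (σ₁ s b) (σ s u) (σ s w)))

initLast-∷ʳ : {A : Set} (w : List A) (b : A) → initLast (w ∷ʳ b) ≡ (w ∷ʳ′ b)
initLast-∷ʳ []      b = refl
initLast-∷ʳ (c ∷ w) b rewrite initLast-∷ʳ w b = refl

Sw-∷ʳ : (s : Qt) (w : Word) (b : Letter) → Sw s (w ∷ʳ b) ≡ σ s w · letterH b
Sw-∷ʳ s w b rewrite initLast-∷ʳ w b = refl

∷-as-∷ʳ : {A : Set} (b : A) (w : List A) → ∃₂ λ w₀ b₀ → b ∷ w ≡ w₀ ∷ʳ b₀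
∷-as-∷ʳ b []      = [] , b , refl
∷-as-∷ʳ b (c ∷ w) with ∷-as-∷ʳ c w
... | w₀ , b₀ , eq = b ∷ w₀ , b₀ , cong (b ∷_) eq

Sw-++ : (s : Qt) (u : Word) (b : Letter) (w : Word) → Sw s (u ++ b ∷ w) ≋ σ s u · Sw s (b ∷ w)
Sw-++ s u b w with ∷-as-∷ʳ b w
... | w₀ , b₀ , eq = ≡-subst (λ v → Sw s (u ++ v) ≋ σ s u · Sw s v) (sym eq) Sw-++-∷ʳ
  where
  Sw-++-∷ʳ : Sw s (u ++ w₀ ∷ʳ b₀) ≋ σ s u · Sw s (w₀ ∷ʳ b₀)
  Sw-++-∷ʳ rewrite sym (LP.++-assoc u w₀ [ b₀ ]) | Sw-∷ʳ s (u ++ w₀) b₀ | Sw-∷ʳ s w₀ b₀ =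
    ≋-trans (·-congˡ (letterH b₀) (σ-++ s u w₀)) (·-assoc (σ s u) (σ s w₀) (letterH b₀))

NonEmptyWords : H → Set
NonEmptyWords []                   = ⊤
NonEmptyWords ((_ , _ , [])    ∷ p) = ⊥
NonEmptyWords ((_ , _ , _ ∷ _) ∷ p) = NonEmptyWords p

NonEmptyWords-++ : (p r : H) → NonEmptyWords p → NonEmptyWords r → NonEmptyWords (p ++ r)
NonEmptyWords-++ []                       r _  ner = ner
NonEmptyWords-++ ((_ , _ , _ ∷ _) ∷ p) r nep ner = NonEmptyWords-++ p r nep ner

NonEmptyWords-prefix : (b : Letter) (v : Word) (p : H) → NonEmptyWords (prefix (b ∷ v) p)
NonEmptyWords-prefix b v []      = _
NonEmptyWords-prefix b v (_ ∷ p) = NonEmptyWords-prefix b v p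

NonEmptyWords-prefix-z : (m : ℕ) (p : H) → NonEmptyWords (prefix (z (suc m)) p)
NonEmptyWords-prefix-z zero    p = NonEmptyWords-prefix Y [] p
NonEmptyWords-prefix-z (suc m) p = NonEmptyWords-prefix X _ p

NonEmptyWords-⨁ : (n : ℕ) (f : ℕ → H) → (∀ i → NonEmptyWords (f i)) → NonEmptyWords (⨁ n f)
NonEmptyWords-⨁ zero    f ne = _
NonEmptyWords-⨁ (suc n) f ne = NonEmptyWords-++ (f 0) _ (ne 0) (NonEmptyWords-⨁ n (f ∘ suc) (ne ∘ suc))

-- S_s(u w) = σ_s(u) S_s(w) needs w ≠ [], since S_s leaves the last letter alone.
Sₛ-prefix : (s : Qt) (u : Word) (p : H) → NonEmptyWords p → Sₛ s (prefix u p) ≋ σ s u · Sₛ s p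
Sₛ-prefix s u []                       _  = ≋-sym (linear-[] (·-linearʳ (σ s u)))
Sₛ-prefix s u ((q , m , b ∷ w) ∷ p) ne =
  ≋-trans (++-cong (≋-trans (linear-cong (scaleMap-linear q (shiftT m)) (Sw-++ s u b w))
                            (≋-sym (·-scaleMap (σ s u) q m (Sw s (b ∷ w)))))
                   (Sₛ-prefix s u p ne))
          (≋-sym (linear-++ (·-linearʳ (σ s u)) (scaleMap q (shiftT m) (Sw s (b ∷ w))) (Sₛ s p)))

replicate-X-++-z : (p m : ℕ) → replicate p X ++ z (suc m) ≡ z (suc (p ℕ.+ m))
replicate-X-++-z zero    m = refl
replicate-X-++-z (suc p) m = cong (X ∷_) (replicate-X-++-z p m)

σ-replicate-X : (s : Qt) (m : ℕ) → σ s (replicate m X) ≋ wordH (replicate m X)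
σ-replicate-X s zero    = ≋-refl
σ-replicate-X s (suc m) = ≋-trans (·-congʳ (letterH X) (σ-replicate-X s m)) (wordH-· [ X ] (wordH (replicate m X)))

Sw-z : (s : Qt) (m : ℕ) → Sw s (z (suc m)) ≋ wordH (z (suc m))
Sw-z s m rewrite Sw-∷ʳ s (replicate m X) Y =
  ≋-trans (·-congˡ (letterH Y) (σ-replicate-X s m)) (wordH-· (replicate m X) (letterH Y))

σ-z : (s : Qt) (m : ℕ) → σ s (z (suc m)) ≋ wordH (z (suc m)) ++ scaleQt s (wordH (replicate (suc m) X))
σ-z s zero    = ≋-trans (·-oneH (σ₁ s Y)) (++-comm-≋ (scaleQt s (letterH X)) (letterH Y))
σ-z s (suc m) =
  ≋-trans (·-congʳ (letterH X) (σ-z s m))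
  (≋-trans (wordH-· [ X ] (wordH (z (suc m)) ++ scaleQt s (wordH (replicate (suc m) X))))
  (≋-trans (linear-++ (prefix-linear [ X ]) (wordH (z (suc m))) (scaleQt s (wordH (replicate (suc m) X))))
           (++-cong ≋-refl (prefix-scaleQt [ X ] s (wordH (replicate (suc m) X))))))

σ-z-· : (s : Qt) (m : ℕ) (p : H) →
  σ s (z (suc m)) · p ≋ prefix (z (suc m)) p ++ scaleQt s (prefix (replicate (suc m) X) p)
σ-z-· s m p =
  ≋-trans (·-congˡ p (σ-z s m))
  (≋-trans (·-++ˡ (wordH (z (suc m))) (scaleQt s (wordH (replicate (suc m) X))) p)
           (++-cong (wordH-· (z (suc m)) p)
                    (≋-trans (scaleQt-· s (wordH (replicate (suc m) X)) p)
                             (linear-cong (scaleQt-linear s) (wordH-· (replicate (suc m) X) p)))))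

-- The harmonic product

harmPairing : (Monomial → ℚ) → Monomial → Monomial → ℚ
harmPairing g (m , u) (n , w) = ev (g ∘ shiftT (m ℕ.+ n)) (harmW u w)

ev-∗ : (g : Monomial → ℚ) (p r : H) → ev g (p ∗ r) ≡ ev (λ b → ev (harmPairing g b) r) p
ev-∗ g []              r = refl
ev-∗ g ((q , m , u) ∷ p) r = trans (ev-++ g (row r) (p ∗ r)) (cong₂ _+_ (ev-row r) (ev-∗ g p r))
  where
  row : H → H
  row = concatMap λ { (q' , n , w) → scaleH (q * q') (m ℕ.+ n) (harmW u w) }
  ev-row : (r : H) → ev g (row r) ≡ q * ev (harmPairing g (m , u)) r
  ev-row []                = sym (ℚP.*-zeroʳ q)
  ev-row ((q' , n , w) ∷ r) =
    trans (ev-++ g (scaleH (q * q') (m ℕ.+ n) (harmW u w)) (row r))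
    (trans (cong₂ _+_ (ev-scaleMap g (q * q') (shiftT (m ℕ.+ n)) (harmW u w)) (ev-row r))
           (solve 4 (λ q q' x Z → q :* q' :* x :+ q :* Z := q :* (q' :* x :+ Z)) refl
                  q q' (harmPairing g (m , u) (n , w)) (ev (harmPairing g (m , u)) r)))

∗-linearˡ : (r : H) → Linear (_∗ r)
∗-linearˡ r = record { dual = λ g b → ev (harmPairing g b) r ; ev-dual = λ g p → ev-∗ g p r }

∗-linearʳ : (p : H) → Linear (p ∗_)
∗-linearʳ p = record
  { dual = λ g c → ev (λ b → harmPairing g b c) p
  ; ev-dual = λ g r → trans (ev-∗ g p r) (ev-comm (harmPairing g) p r) }

∗-congˡ : (r : H) {p p' : H} → p ≋ p' → p ∗ r ≋ p' ∗ r
∗-congˡ r = linear-cong (∗-linearˡ r)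

∗-congʳ : (p : H) {r r' : H} → r ≋ r' → p ∗ r ≋ p ∗ r'
∗-congʳ p = linear-cong (∗-linearʳ p)

scaleQt-∗ : (s : Qt) (p r : H) → scaleQt s p ∗ r ≋ scaleQt s (p ∗ r)
scaleQt-∗ s p r = mk≋ λ g → begin
  ev g (scaleQt s p ∗ r)                                            ≡⟨ ev-∗ g (scaleQt s p) r ⟩
  ev (λ b → ev (harmPairing g b) r) (scaleQt s p)                   ≡⟨ ev-scaleQt _ s p ⟩
  ev (λ m → ev (λ b → ev (harmPairing g (shiftT m b)) r) p) s
    ≡⟨ ev-cong s (λ m → ev-cong p λ { (d , u) → ev-cong r λ { (n , w) → ev-cong (harmW u w) λ { (e , v) →
         cong (λ x → g (x , v)) (trans (cong (ℕ._+ e) (ℕP.+-assoc m d n)) (ℕP.+-assoc m (d ℕ.+ n) e)) } } }) ⟩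
  ev (λ m → ev (λ b → ev (harmPairing (g ∘ shiftT m) b) r) p) s     ≡⟨ ev-cong s (λ m → ev-∗ (g ∘ shiftT m) p r) ⟨
  ev (λ m → ev (g ∘ shiftT m) (p ∗ r)) s                            ≡⟨ ev-scaleQt g s (p ∗ r) ⟨
  ev g (scaleQt s (p ∗ r))                                          ∎

∗-scaleQt : (s : Qt) (p r : H) → p ∗ scaleQt s r ≋ scaleQt s (p ∗ r)
∗-scaleQt s p r = mk≋ λ g → begin
  ev g (p ∗ scaleQt s r)                                            ≡⟨ ev-dual (∗-linearʳ p) g (scaleQt s r) ⟩
  ev (λ c → ev (λ b → harmPairing g b c) p) (scaleQt s r)           ≡⟨ ev-scaleQt _ s r ⟩
  ev (λ m → ev (λ c → ev (λ b → harmPairing g b (shiftT m c)) p) r) s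
    ≡⟨ ev-cong s (λ m → ev-cong r λ { (n , w) → ev-cong p λ { (d , u) → ev-cong (harmW u w) λ { (e , v) →
         cong (λ x → g (x , v)) (reassoc d m n e) } } }) ⟩
  ev (λ m → ev (λ c → ev (λ b → harmPairing (g ∘ shiftT m) b c) p) r) s
    ≡⟨ ev-cong s (λ m → ev-dual (∗-linearʳ p) (g ∘ shiftT m) r) ⟨
  ev (λ m → ev (g ∘ shiftT m) (p ∗ r)) s                            ≡⟨ ev-scaleQt g s (p ∗ r) ⟨
  ev g (scaleQt s (p ∗ r))                                          ∎
  where
  reassoc : (d m n e : ℕ) → d ℕ.+ (m ℕ.+ n) ℕ.+ e ≡ m ℕ.+ (d ℕ.+ n ℕ.+ e)
  reassoc d m n e = begin
    d ℕ.+ (m ℕ.+ n) ℕ.+ e   ≡⟨ cong (ℕ._+ e) (sym (ℕP.+-assoc d m n)) ⟩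
    d ℕ.+ m ℕ.+ n ℕ.+ e     ≡⟨ cong (λ x → x ℕ.+ n ℕ.+ e) (ℕP.+-comm d m) ⟩
    m ℕ.+ d ℕ.+ n ℕ.+ e     ≡⟨ cong (ℕ._+ e) (ℕP.+-assoc m d n) ⟩
    m ℕ.+ (d ℕ.+ n) ℕ.+ e   ≡⟨ ℕP.+-assoc m (d ℕ.+ n) e ⟩
    m ℕ.+ (d ℕ.+ n ℕ.+ e)   ∎

scaleQt-∗-scaleQt : (α β : Qt) (p r : H) → scaleQt α p ∗ scaleQt β r ≋ scaleQt (α *Qt β) (p ∗ r)
scaleQt-∗-scaleQt α β p r =
  ≋-trans (scaleQt-∗ α p (scaleQt β r))
  (≋-trans (linear-cong (scaleQt-linear α) (∗-scaleQt β p r)) (≋-sym (scaleQt-*Qt α β (p ∗ r))))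

parse-z : (m : ℕ) (w : Word) → parse (z (suc m) ++ w) ≡ suc m ∷ parse w
parse-z zero    w = refl
parse-z (suc m) w rewrite parse-z m w = refl

harmC-[]ʳ : (ks : List ℕ) → harmC ks [] ≡ [ ks ]
harmC-[]ʳ []       = refl
harmC-[]ʳ (k ∷ ks) = refl

harmWord : List ℕ → ℚ × ℕ × Word
harmWord ks = (1ℚ , 0 , zs ks)

map-harmWord-∷ : (k : ℕ) (kss : List (List ℕ)) → map harmWord (map (k ∷_) kss) ≡ prefix (z k) (map harmWord kss)
map-harmWord-∷ k []         = refl
map-harmWord-∷ k (ks ∷ kss) = cong (harmWord (k ∷ ks) ∷_) (map-harmWord-∷ k kss)

harmW-z-z : (k l : ℕ) (u w : Word) →
  harmW (z (suc k) ++ u) (z (suc l) ++ w) ≡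
  prefix (z (suc k)) (harmW u (z (suc l) ++ w)) ++
  prefix (z (suc l)) (harmW (z (suc k) ++ u) w) ++
  prefix (z (suc k ℕ.+ suc l)) (harmW u w)
harmW-z-z k l u w rewrite parse-z k u | parse-z l w =
  trans (LP.map-++ harmWord (map (suc k ∷_) (harmC (parse u) (suc l ∷ parse w))) _)
  (cong₂ _++_ (map-harmWord-∷ (suc k) (harmC (parse u) (suc l ∷ parse w)))
    (trans (LP.map-++ harmWord (map (suc l ∷_) (harmC (suc k ∷ parse u) (parse w)))
                               (map (suc k ℕ.+ suc l ∷_) (harmC (parse u) (parse w))))
      (cong₂ _++_ (map-harmWord-∷ (suc l) (harmC (suc k ∷ parse u) (parse w)))
                  (map-harmWord-∷ (suc k ℕ.+ suc l) (harmC (parse u) (parse w))))))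

harmW-[]-z : (l : ℕ) (w : Word) → harmW [] (z (suc l) ++ w) ≡ prefix (z (suc l)) (harmW [] w)
harmW-[]-z l w rewrite parse-z l w = refl

harmW-z-[] : (k : ℕ) (u : Word) → harmW (z (suc k) ++ u) [] ≡ prefix (z (suc k)) (harmW u [])
harmW-z-[] k u rewrite parse-z k u | harmC-[]ʳ (parse u) = refl

ev-oneH-∗ : (g : Monomial → ℚ) (r : H) → ev g (oneH ∗ r) ≡ ev (harmPairing g (0 , [])) r
ev-oneH-∗ g r = trans (ev-∗ g oneH r) (trans (ℚP.+-identityʳ _) (ℚP.*-identityˡ _))

ev-∗-oneH : (g : Monomial → ℚ) (p : H) → ev g (p ∗ oneH) ≡ ev (λ b → harmPairing g b (0 , [])) p
ev-∗-oneH g p = trans (ev-∗ g p oneH) (ev-cong p (λ b → trans (ℚP.+-identityʳ _) (ℚP.*-identityˡ _)))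

oneH-∗-oneH : oneH ∗ oneH ≋ oneH
oneH-∗-oneH = ≋-refl

oneH-∗-prefix : (l : ℕ) (r : H) → oneH ∗ prefix (z (suc l)) r ≋ prefix (z (suc l)) (oneH ∗ r)
oneH-∗-prefix l r = mk≋ λ g → begin
  ev g (oneH ∗ prefix zl r)                               ≡⟨ ev-oneH-∗ g (prefix zl r) ⟩
  ev (harmPairing g (0 , [])) (prefix zl r)               ≡⟨ ev-mapBasis _ (prefixMonomial zl) r ⟩
  ev (λ c → harmPairing g (0 , []) (prefixMonomial zl c)) r
    ≡⟨ ev-cong r (λ { (n , w) → trans (cong (ev (g ∘ shiftT n)) (harmW-[]-z l w)) (ev-mapBasis (g ∘ shiftT n) (prefixMonomial zl) (harmW [] w)) }) ⟩
  ev (harmPairing (g ∘ prefixMonomial zl) (0 , [])) r     ≡⟨ ev-oneH-∗ (g ∘ prefixMonomial zl) r ⟨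
  ev (g ∘ prefixMonomial zl) (oneH ∗ r)                   ≡⟨ ev-mapBasis g (prefixMonomial zl) (oneH ∗ r) ⟨
  ev g (prefix zl (oneH ∗ r))                             ∎
  where zl = z (suc l)

prefix-∗-oneH : (k : ℕ) (p : H) → prefix (z (suc k)) p ∗ oneH ≋ prefix (z (suc k)) (p ∗ oneH)
prefix-∗-oneH k p = mk≋ λ g → begin
  ev g (prefix zk p ∗ oneH)                               ≡⟨ ev-∗-oneH g (prefix zk p) ⟩
  ev (λ b → harmPairing g b (0 , [])) (prefix zk p)       ≡⟨ ev-mapBasis _ (prefixMonomial zk) p ⟩
  ev (λ b → harmPairing g (prefixMonomial zk b) (0 , [])) p
    ≡⟨ ev-cong p (λ { (m , u) → trans (cong (ev (g ∘ shiftT (m ℕ.+ 0))) (harmW-z-[] k u))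
                                      (ev-mapBasis _ (prefixMonomial zk) (harmW u [])) }) ⟩
  ev (λ b → harmPairing (g ∘ prefixMonomial zk) b (0 , [])) p ≡⟨ ev-∗-oneH (g ∘ prefixMonomial zk) p ⟨
  ev (g ∘ prefixMonomial zk) (p ∗ oneH)                   ≡⟨ ev-mapBasis g (prefixMonomial zk) (p ∗ oneH) ⟨
  ev g (prefix zk (p ∗ oneH))                             ∎
  where zk = z (suc k)

ev-prefix-∗ : (g : Monomial → ℚ) (u w : Word) (p r : H) →
  ev g (prefix u p ∗ prefix w r) ≡ ev (λ b → ev (λ c → harmPairing g (prefixMonomial u b) (prefixMonomial w c)) r) p
ev-prefix-∗ g u w p r = begin
  ev g (prefix u p ∗ prefix w r)                                  ≡⟨ ev-∗ g (prefix u p) (prefix w r) ⟩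
  ev (λ b → ev (harmPairing g b) (prefix w r)) (prefix u p)       ≡⟨ ev-mapBasis _ (prefixMonomial u) p ⟩
  ev (λ b → ev (harmPairing g (prefixMonomial u b)) (prefix w r)) p
    ≡⟨ ev-cong p (λ b → ev-mapBasis _ (prefixMonomial w) r) ⟩
  ev (λ b → ev (λ c → harmPairing g (prefixMonomial u b) (prefixMonomial w c)) r) p ∎

harmPairing-z-z : (k l : ℕ) (g : Monomial → ℚ) (b c : Monomial) →
  harmPairing g (prefixMonomial (z (suc k)) b) (prefixMonomial (z (suc l)) c) ≡
  harmPairing (g ∘ prefixMonomial (z (suc k))) b (prefixMonomial (z (suc l)) c) +
  (harmPairing (g ∘ prefixMonomial (z (suc l))) (prefixMonomial (z (suc k)) b) c +
   harmPairing (g ∘ prefixMonomial (z (suc k ℕ.+ suc l))) b c)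
harmPairing-z-z k l g (m , u) (n , w) = begin
  ev g′ (harmW (zk ++ u) (zl ++ w))                      ≡⟨ cong (ev g′) (harmW-z-z k l u w) ⟩
  ev g′ (prefix zk U₁ ++ prefix zl U₂ ++ prefix zkl U₃)
    ≡⟨ trans (ev-++ g′ (prefix zk U₁) (prefix zl U₂ ++ prefix zkl U₃)) (cong (ev g′ (prefix zk U₁) +_) (ev-++ g′ (prefix zl U₂) (prefix zkl U₃))) ⟩
  ev g′ (prefix zk U₁) + (ev g′ (prefix zl U₂) + ev g′ (prefix zkl U₃))
    ≡⟨ cong₂ _+_ (ev-mapBasis g′ (prefixMonomial zk) U₁)
                 (cong₂ _+_ (ev-mapBasis g′ (prefixMonomial zl) U₂) (ev-mapBasis g′ (prefixMonomial zkl) U₃)) ⟩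
  ev (g′ ∘ prefixMonomial zk) U₁ + (ev (g′ ∘ prefixMonomial zl) U₂ + ev (g′ ∘ prefixMonomial zkl) U₃) ∎
  where
  zk = z (suc k)
  zl = z (suc l)
  zkl = z (suc k ℕ.+ suc l)
  g′ = g ∘ shiftT (m ℕ.+ n)
  U₁ = harmW u (zl ++ w)
  U₂ = harmW (zk ++ u) w
  U₃ = harmW u w

prefix-∗-prefix : (k l : ℕ) (p r : H) →
  prefix (z (suc k)) p ∗ prefix (z (suc l)) r ≋
  prefix (z (suc k)) (p ∗ prefix (z (suc l)) r) ++
  prefix (z (suc l)) (prefix (z (suc k)) p ∗ r) ++
  prefix (z (suc k ℕ.+ suc l)) (p ∗ r)
prefix-∗-prefix k l p r = mk≋ λ g → begin
  ev g (prefix zk p ∗ prefix zl r)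
    ≡⟨ ev-prefix-∗ g zk zl p r ⟩
  ev (λ b → ev (λ c → harmPairing g (pk b) (pl c)) r) p
    ≡⟨ ev-cong p (λ b → ev-cong r (λ c → harmPairing-z-z k l g b c)) ⟩
  ev (λ b → ev (λ c → T₁ g b c + (T₂ g b c + T₃ g b c)) r) p
    ≡⟨ trans (ev²-+ (T₁ g) (λ b c → T₂ g b c + T₃ g b c) p r) (cong (ev (λ b → ev (T₁ g b) r) p +_) (ev²-+ (T₂ g) (T₃ g) p r)) ⟩
  ev (λ b → ev (T₁ g b) r) p + (ev (λ b → ev (T₂ g b) r) p + ev (λ b → ev (T₃ g b) r) p)
    ≡⟨ cong₂ _+_ (ev-T₁ g) (cong₂ _+_ (ev-T₂ g) (ev-T₃ g)) ⟨
  ev g L₁ + (ev g L₂ + ev g L₃)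
    ≡⟨ trans (ev-++ g L₁ (L₂ ++ L₃)) (cong (ev g L₁ +_) (ev-++ g L₂ L₃)) ⟨
  ev g (L₁ ++ L₂ ++ L₃) ∎
  where
  zk = z (suc k)
  zl = z (suc l)
  zkl = z (suc k ℕ.+ suc l)
  pk = prefixMonomial zk
  pl = prefixMonomial zl
  L₁ = prefix zk (p ∗ prefix zl r)
  L₂ = prefix zl (prefix zk p ∗ r)
  L₃ = prefix zkl (p ∗ r)
  T₁ T₂ T₃ : (Monomial → ℚ) → Monomial → Monomial → ℚ
  T₁ g b c = harmPairing (g ∘ pk) b (pl c)
  T₂ g b c = harmPairing (g ∘ pl) (pk b) c
  T₃ g b c = harmPairing (g ∘ prefixMonomial zkl) b c
  ev-T₁ : (g : Monomial → ℚ) → ev g L₁ ≡ ev (λ b → ev (T₁ g b) r) p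
  ev-T₁ g = trans (ev-mapBasis g pk (p ∗ prefix zl r))
    (trans (ev-∗ (g ∘ pk) p (prefix zl r)) (ev-cong p (λ b → ev-mapBasis (harmPairing (g ∘ pk) b) pl r)))
  ev-T₂ : (g : Monomial → ℚ) → ev g L₂ ≡ ev (λ b → ev (T₂ g b) r) p
  ev-T₂ g = trans (ev-mapBasis g pl (prefix zk p ∗ r))
    (trans (ev-∗ (g ∘ pl) (prefix zk p) r) (ev-mapBasis (λ b → ev (harmPairing (g ∘ pl) b) r) pk p))
  ev-T₃ : (g : Monomial → ℚ) → ev g L₃ ≡ ev (λ b → ev (T₃ g b) r) p
  ev-T₃ g = trans (ev-mapBasis g (prefixMonomial zkl) (p ∗ r)) (ev-∗ (g ∘ prefixMonomial zkl) p r)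

-- Polynomials in v over h_t

-- t-degree, v-degree, word
GradedMonomial : Set
GradedMonomial = ℕ × ℕ × Word

HV : Set
HV = Lin GradedMonomial

atMonomial : ℕ → Monomial → GradedMonomial
atMonomial r (m , w) = (m , r , w)

atV : ℕ → H → HV
atV r = mapBasis (atMonomial r)

prefixGraded : Word → GradedMonomial → GradedMonomial
prefixGraded u (m , d , w) = (m , d , u ++ w)

prefixV : Word → HV → HV
prefixV u = mapBasis (prefixGraded u)

shiftTV : ℕ × ℕ → GradedMonomial → GradedMonomial
shiftTV (m , d) (m' , d' , w) = (m ℕ.+ m' , d ℕ.+ d' , w)

addTV : ℕ × ℕ → ℕ × ℕ → ℕ × ℕ
addTV (m , d) (m' , d') = (m ℕ.+ m' , d ℕ.+ d')

infixr 7 _⊙_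
_⊙_ : QtV → HV → HV
_⊙_ = convolve shiftTV

oneV vV tvV : QtV
oneV = [ (1ℚ , 0 , 0) ]
vV   = [ (1ℚ , 0 , 1) ]
tvV  = [ (1ℚ , 1 , 1) ]

⊙-linear : (c : QtV) → Linear (c ⊙_)
⊙-linear = convolve-linearʳ shiftTV

⊙-congˡ : (Z : HV) {c c' : QtV} → c ≋ c' → c ⊙ Z ≋ c' ⊙ Z
⊙-congˡ Z = linear-cong (convolve-linearˡ shiftTV Z)

⊙-++ˡ : (c c' : QtV) (Z : HV) → (c ++ c') ⊙ Z ≋ c ⊙ Z ++ c' ⊙ Z
⊙-++ˡ c c' Z = linear-++ (convolve-linearˡ shiftTV Z) c c'

⨁-⊙ : (n : ℕ) (c : ℕ → QtV) (Z : HV) → ⨁ n (λ i → c i ⊙ Z) ≋ ⨁ n c ⊙ Z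
⨁-⊙ n c Z = ≋-sym (linear-⨁ (convolve-linearˡ shiftTV Z) n c)

⊙-[] : (c : QtV) → c ⊙ [] ≋ []
⊙-[] c = linear-[] (⊙-linear c)

*V-⊙ : (c c' : QtV) (Z : HV) → (c *V c') ⊙ Z ≋ c ⊙ (c' ⊙ Z)
*V-⊙ = convolve-assoc λ { (m , d) (m' , d') (n , e , w) →
  cong₂ (λ x y → (x , y , w)) (ℕP.+-assoc m m' n) (ℕP.+-assoc d d' e) }

oneV-⊙ : (Z : HV) → oneV ⊙ Z ≋ Z
oneV-⊙ Z = ≋-trans (convolve-unitˡ shiftTV (0 , 0) Z) (mapBasis-id Z)

⊙-prefixV : (c : QtV) (u : Word) (Z : HV) → c ⊙ prefixV u Z ≋ prefixV u (c ⊙ Z)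
⊙-prefixV c u Z = ≋-trans (convolve-mapBasisʳ shiftTV _ c Z) (≋-sym (mapBasis-convolve _ shiftTV c Z))

prefixV-linear : (u : Word) → Linear (prefixV u)
prefixV-linear u = mapBasis-linear _

atV-linear : (r : ℕ) → Linear (atV r)
atV-linear r = mapBasis-linear _

prefixV-prefixV : (u w : Word) (Z : HV) → prefixV u (prefixV w Z) ≋ prefixV (u ++ w) Z
prefixV-prefixV u w Z = ≋-trans (mapBasis-∘ _ _ Z)
  (mapBasis-ext (λ { (m , d , v) → cong (λ x → (m , d , x)) (sym (LP.++-assoc u w v)) }) Z)

prefixV-≡ : {u u' : Word} → u ≡ u' → (Z : HV) → prefixV u Z ≋ prefixV u' Z
prefixV-≡ refl Z = ≋-refl

prefixV-atV : (u : Word) (r : ℕ) (h : H) → prefixV u (atV r h) ≋ atV r (prefix u h)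
prefixV-atV u r h = ≋-trans (mapBasis-∘ _ _ h) (≋-sym (mapBasis-∘ _ _ h))

atV-suc : (r : ℕ) (h : H) → atV (suc r) h ≋ vV ⊙ atV r h
atV-suc r h = ≋-sym (≋-trans (convolve-unitˡ shiftTV (0 , 1) (atV r h)) (mapBasis-∘ _ _ h))

atV-suc-scaleQt-t : (r : ℕ) (h : H) → atV (suc r) (scaleQt tQ h) ≋ tvV ⊙ atV r h
atV-suc-scaleQt-t r h =
  ≋-trans (mapBasis-convolve (atMonomial (suc r)) shiftT tQ h)
  (≋-trans (convolve-unitˡ (λ m c → atMonomial (suc r) (shiftT m c)) 1 h)
  (≋-sym (≋-trans (convolve-mapBasisʳ shiftTV (atMonomial r) tvV h)
                  (convolve-unitˡ (λ b c → shiftTV b (atMonomial r c)) (1 , 1) h))))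

_⊙₀_ : QtV → H → HV
c ⊙₀ h = c ⊙ atV 0 h

⊙₀-linear : (c : QtV) → Linear (c ⊙₀_)
⊙₀-linear c = linear-∘ (⊙-linear c) (atV-linear 0)

⊙₀-prefix : (c : QtV) (u : Word) (h : H) → c ⊙₀ prefix u h ≋ c ⊙ prefixV u (atV 0 h)
⊙₀-prefix c u h = linear-cong (⊙-linear c) (≋-sym (prefixV-atV u 0 h))

⊙₀-⨁-prefix : (c : QtV) (n : ℕ) (u : ℕ → Word) (h : ℕ → H) →
  c ⊙₀ ⨁ n (λ m → prefix (u m) (h m)) ≋ ⨁ n (λ m → c ⊙ prefixV (u m) (atV 0 (h m)))
⊙₀-⨁-prefix c n u h = ≋-trans (linear-⨁ (⊙₀-linear c) n (λ m → prefix (u m) (h m)))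
                              (⨁-cong n (λ m → ⊙₀-prefix c (u m) (h m)))

⨁-⊙-prefixV : (n : ℕ) (c : QtV) (u : Word) (f : ℕ → HV) → ⨁ n (λ r → c ⊙ prefixV u (f r)) ≋ c ⊙ prefixV u (⨁ n f)
⨁-⊙-prefixV n c u f = ≋-sym (≋-trans (linear-cong (⊙-linear c) (linear-⨁ (prefixV-linear u) n f))
                                     (linear-⨁ (⊙-linear c) n (prefixV u ∘ f)))

atV-suc-prefix : (r : ℕ) (u : Word) (h : H) → atV (suc r) (prefix u h) ≋ vV ⊙ prefixV u (atV r h)
atV-suc-prefix r u h = ≋-trans (atV-suc r (prefix u h)) (linear-cong (⊙-linear vV) (≋-sym (prefixV-atV u r h)))

atV-suc-t-prefix : (r : ℕ) (u : Word) (h : H) → atV (suc r) (scaleQt tQ (prefix u h)) ≋ tvV ⊙ prefixV u (atV r h)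
atV-suc-t-prefix r u h =
  ≋-trans (atV-suc-scaleQt-t r (prefix u h)) (linear-cong (⊙-linear tvV) (≋-sym (prefixV-atV u r h)))

*V-congˡ : (d : QtV) {c c' : QtV} → c ≋ c' → c *V d ≋ c' *V d
*V-congˡ d = linear-cong (convolve-linearˡ addTV d)

*V-congʳ : (c : QtV) {d d' : QtV} → d ≋ d' → c *V d ≋ c *V d'
*V-congʳ c = linear-cong (convolve-linearʳ addTV c)

*V-comm : (c d : QtV) → c *V d ≋ d *V c
*V-comm = convolve-comm λ { (m , d) (m' , d') → cong₂ _,_ (ℕP.+-comm m m') (ℕP.+-comm d d') }

*V-assoc : (c d e : QtV) → (c *V d) *V e ≋ c *V (d *V e)
*V-assoc = convolve-assoc λ { (m , d) (m' , d') (n , e) → cong₂ _,_ (ℕP.+-assoc m m' n) (ℕP.+-assoc d d' e) }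

*V-++ʳ : (c d e : QtV) → c *V (d ++ e) ≋ c *V d ++ c *V e
*V-++ʳ c = linear-++ (convolve-linearʳ addTV c)

*V-++ˡ : (c d e : QtV) → (d ++ e) *V c ≋ d *V c ++ e *V c
*V-++ˡ c = linear-++ (convolve-linearˡ addTV c)

*V-⨁ : (c : QtV) (n : ℕ) (d : ℕ → QtV) → c *V ⨁ n d ≋ ⨁ n (λ i → c *V d i)
*V-⨁ c = linear-⨁ (convolve-linearʳ addTV c)

oneV-*V : (c : QtV) → oneV *V c ≋ c
oneV-*V c = ≋-trans (convolve-unitˡ addTV (0 , 0) c) (mapBasis-id c)

*V-oneV : (c : QtV) → c *V oneV ≋ c
*V-oneV c = ≋-trans (*V-comm c oneV) (oneV-*V c)

powV-+ : (c : QtV) (m n : ℕ) → powV c (m ℕ.+ n) ≋ powV c m *V powV c n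
powV-+ c zero    n = ≋-sym (oneV-*V (powV c n))
powV-+ c (suc m) n = ≋-trans (*V-congʳ c (powV-+ c m n)) (≋-sym (*V-assoc c (powV c m) (powV c n)))

c₁+c₂≋v : c₁ ++ c₂ ≋ vV
c₁+c₂≋v = mk≋ λ g →
  solve 3 (λ x y w → con 1ℚ :* x :+ (con (- 1ℚ) :* y :+ (con (- 1ℚ) :* w :+ (con 1ℚ :* w :+ (con 1ℚ :* y :+ con 0ℚ))))
                     := con 1ℚ :* x :+ con 0ℚ) refl (g (0 , 1)) (g (1 , 1)) (g (0 , 0))

c^ : ℕ → ℕ → QtV
c^ i l = powV c₁ i *V powV c₂ l

c^-suc : (i l : ℕ) → c^ (suc i) l ≋ c₁ *V c^ i l
c^-suc i l = *V-assoc c₁ (powV c₁ i) (powV c₂ l)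

c^-shift : (e : QtV) (i m r : ℕ) → e *V c^ i (suc m ℕ.+ r) ≋ (e *V powV c₂ (suc m)) *V c^ i r
c^-shift e i m r = begin≋
  e *V (x *V powV c₂ (suc m ℕ.+ r))  ≋⟨ *V-congʳ e (*V-congʳ x (powV-+ c₂ (suc m) r)) ⟩
  e *V (x *V (y *V w))                ≋⟨ *V-congʳ e (≋-sym (*V-assoc x y w)) ⟩
  e *V ((x *V y) *V w)                ≋⟨ *V-congʳ e (*V-congˡ w (*V-comm x y)) ⟩
  e *V ((y *V x) *V w)                ≋⟨ *V-congʳ e (*V-assoc y x w) ⟩
  e *V (y *V (x *V w))                ≋⟨ ≋-sym (*V-assoc e y (x *V w)) ⟩
  (e *V y) *V (x *V w)                ∎≋
  where
  open ≋-Reasoning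
  x = powV c₁ i
  y = powV c₂ (suc m)
  w = powV c₂ r

v*c₂^-split : (m : ℕ) (Z : HV) → (vV *V powV c₂ m) ⊙ Z ≋ (c₁ *V powV c₂ m) ⊙ Z ++ powV c₂ (suc m) ⊙ Z
v*c₂^-split m Z =
  ≋-trans (⊙-congˡ Z (≋-trans (*V-congˡ (powV c₂ m) (≋-sym c₁+c₂≋v)) (*V-++ˡ (powV c₂ m) c₁ c₂)))
          (⊙-++ˡ (c₁ *V powV c₂ m) (c₂ *V powV c₂ m) Z)

c₂^-geometric : (s : ℕ) → powV c₂ (suc s) ≋ oneV ++ ⨁ (suc s) (λ c → tvV *V powV c₂ (s ∸ c))
c₂^-geometric zero    = ≋-trans (*V-oneV c₂) (++-congʳ oneV (≋-sym (≋-trans (++-identityʳ-≋ (tvV *V oneV)) (*V-oneV tvV))))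
c₂^-geometric (suc s) = begin≋
  -- c₂ is oneV ++ tvV on the nose.
  (oneV ++ tvV) *V D                  ≋⟨ *V-++ˡ D oneV tvV ⟩
  oneV *V D ++ tvV *V D               ≋⟨ ++-congˡ (tvV *V D) (≋-trans (oneV-*V D) (c₂^-geometric s)) ⟩
  (oneV ++ R) ++ tvV *V D             ≋⟨ ++-assoc-≋ oneV R (tvV *V D) ⟩
  oneV ++ R ++ tvV *V D               ≋⟨ ++-congʳ oneV (++-comm-≋ R (tvV *V D)) ⟩
  oneV ++ tvV *V D ++ R               ∎≋
  where
  open ≋-Reasoning
  D = powV c₂ (suc s)
  R = ⨁ (suc s) (λ c → tvV *V powV c₂ (s ∸ c))

v-tv-comm : (x : QtV) → vV *V (tvV *V x) ≋ tvV *V (vV *V x)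
v-tv-comm x = ≋-trans (≋-sym (*V-assoc vV tvV x)) (≋-trans (*V-congˡ x (*V-comm vV tvV)) (*V-assoc tvV vV x))

v*c₂^-geometric : (s : ℕ) (Z : HV) →
  (vV *V powV c₂ (suc s)) ⊙ Z ≋ vV ⊙ Z ++ ⨁ (suc s) (λ c → (tvV *V (vV *V powV c₂ (s ∸ c))) ⊙ Z)
v*c₂^-geometric s Z = begin≋
  (vV *V powV c₂ (suc s)) ⊙ Z
    ≋⟨ ⊙-congˡ Z (≋-trans (*V-congʳ vV (c₂^-geometric s)) (*V-++ʳ vV oneV R)) ⟩
  (vV *V oneV ++ vV *V R) ⊙ Z
    ≋⟨ ⊙-++ˡ (vV *V oneV) (vV *V R) Z ⟩
  (vV *V oneV) ⊙ Z ++ (vV *V R) ⊙ Z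
    ≋⟨ ++-cong (⊙-congˡ Z (*V-oneV vV))
               (≋-trans (⊙-congˡ Z (*V-⨁ vV (suc s) (λ c → tvV *V powV c₂ (s ∸ c))))
               (≋-trans (≋-sym (⨁-⊙ (suc s) (λ c → vV *V (tvV *V powV c₂ (s ∸ c))) Z))
                        (⨁-cong (suc s) (λ c → ⊙-congˡ Z (v-tv-comm (powV c₂ (s ∸ c))))))) ⟩
  vV ⊙ Z ++ ⨁ (suc s) (λ c → (tvV *V (vV *V powV c₂ (s ∸ c))) ⊙ Z) ∎≋
  where
  open ≋-Reasoning
  R = ⨁ (suc s) (λ c → tvV *V powV c₂ (s ∸ c))

comps-empty : (k n : ℕ) → k < n → comps k n ≡ []
comps-empty zero    (suc n) k<n       = refl
comps-empty (suc k) (suc n) (s≤s k<n) = trans (concatMap-applyUpTo _ id (suc k))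
  (⨁-≡[] (suc k) _ (λ i i≤k → cong (map (suc i ∷_)) (comps-empty (k ∸ i) n (ℕP.≤-<-trans (ℕP.m∸n≤m k i) k<n))))

N-empty : (a k n : ℕ) → k < n → N a k n ≡ []
N-empty a k n k<n = cong (map _) (comps-empty k n k<n)

NWord : ℕ → List ℕ → ℚ × ℕ × Word
NWord a ks = (1ℚ , 0 , zs (map (a ℕ.*_) ks))

map-NWord-∷ : (a k : ℕ) (kss : List (List ℕ)) → map (NWord a) (map (k ∷_) kss) ≡ prefix (z (a ℕ.* k)) (map (NWord a) kss)
map-NWord-∷ a k []         = refl
map-NWord-∷ a k (ks ∷ kss) = cong (NWord a (k ∷ ks) ∷_) (map-NWord-∷ a k kss)

-- Split off the first part of the composition.
N-suc : (a k n : ℕ) → N a k (suc n) ≡ ⨁ k (λ i → prefix (z (a ℕ.* suc i)) (N a (k ∸ suc i) n))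
N-suc a zero    n = refl
N-suc a (suc k) n =
  trans (cong (map (NWord a)) (concatMap-applyUpTo _ id (suc k)))
  (trans (map-⨁ (NWord a) (suc k) (λ i → map (suc i ∷_) (comps (suc k ∸ suc i) n)))
         (⨁-cong-≡ (suc k) (λ i → map-NWord-∷ a (suc i) (comps (suc k ∸ suc i) n))))

NonEmptyWords-N : (a' k r : ℕ) → NonEmptyWords (N (suc a') (suc k) r)
NonEmptyWords-N a' k zero    = _
NonEmptyWords-N a' k (suc r) rewrite N-suc (suc a') (suc k) r =
  NonEmptyWords-⨁ (suc k) (λ i → prefix (z (suc a' ℕ.* suc i)) (N (suc a') (k ∸ i) r))
    (λ i → NonEmptyWords-prefix-z (i ℕ.+ a' ℕ.* suc i) (N (suc a') (k ∸ i) r))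

δ : ℕ → ℕ → ℚ → ℚ
δ d n x = if does (d ℕ.≟ n) then x else 0ℚ

δ-refl : (n : ℕ) (x : ℚ) → δ n n x ≡ x
δ-refl zero    x = refl
δ-refl (suc n) x = δ-refl n x

δ-≢ : (d n : ℕ) (x : ℚ) → d ≢ n → δ d n x ≡ 0ℚ
δ-≢ d n x d≢n = cong (λ b → if b then x else 0ℚ) (dec-false (d ℕ.≟ n) d≢n)

δ-sym : (d n : ℕ) (x : ℚ) → δ d n x ≡ δ n d x
δ-sym zero    zero    x = refl
δ-sym zero    (suc n) x = refl
δ-sym (suc d) zero    x = refl
δ-sym (suc d) (suc n) x = δ-sym d n x

ev-δ : {B : Set} (d n : ℕ) (g : B → ℚ) (p : Lin B) → ev (λ b → δ d n (g b)) p ≡ δ d n (ev g p)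
ev-δ d n g p with does (d ℕ.≟ n)
... | true  = refl
... | false = ev-zero p

∑-δ : (K d : ℕ) (y : ℕ → ℚ) → d < K → ∑ K (λ j → δ d j (y j)) ≡ y d
∑-δ (suc K) zero    y _         = trans (cong (y 0 +_) (∑-zero K)) (ℚP.+-identityʳ (y 0))
∑-δ (suc K) (suc d) y (s≤s d<K) = trans (ℚP.+-identityˡ _) (∑-δ K d (y ∘ suc) d<K)

∑-δ-out-of-range : (K d : ℕ) (y : ℕ → ℚ) → K ≤ d → ∑ K (λ j → δ d j (y j)) ≡ 0ℚ
∑-δ-out-of-range zero    d       y _         = refl
∑-δ-out-of-range (suc K) (suc d) y (s≤s K≤d) = trans (ℚP.+-identityˡ _) (∑-δ-out-of-range K d (y ∘ suc) K≤d)

∑-δ-convolution : (n d₁ d₂ : ℕ) (x : ℚ) → ∑ (suc n) (λ j → δ d₁ j (δ d₂ (n ∸ j) x)) ≡ δ (d₁ ℕ.+ d₂) n x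
∑-δ-convolution n d₁ d₂ x with d₁ ℕ.≤? n
... | yes d₁≤n = trans (∑-δ (suc n) d₁ (λ j → δ d₂ (n ∸ j) x) (s≤s d₁≤n)) (second d₂)
  where
  second : (d₂ : ℕ) → δ d₂ (n ∸ d₁) x ≡ δ (d₁ ℕ.+ d₂) n x
  second d₂ with d₂ ℕ.≟ (n ∸ d₁)
  ... | yes refl = trans (δ-refl (n ∸ d₁) x) (sym (trans (cong (λ t → δ t n x) (ℕP.m+[n∸m]≡n d₁≤n)) (δ-refl n x)))
  ... | no d₂≢   = trans (δ-≢ d₂ (n ∸ d₁) x d₂≢)
                         (sym (δ-≢ (d₁ ℕ.+ d₂) n x (λ e → d₂≢ (trans (sym (ℕP.m+n∸m≡n d₁ d₂)) (cong (_∸ d₁) e)))))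
... | no d₁≰n = trans (∑-δ-out-of-range (suc n) d₁ (λ j → δ d₂ (n ∸ j) x) (ℕP.≰⇒> d₁≰n))
                      (sym (δ-≢ (d₁ ℕ.+ d₂) n x (λ e → d₁≰n (ℕP.≤-trans (ℕP.m≤m+n d₁ d₂) (ℕP.≤-reflexive e)))))

[v^_]_ : ℕ → HV → H
[v^ n ] Z = concatMap (λ { (q , m , d , w) → if does (d ℕ.≟ n) then [ (q , m , w) ] else [] }) Z

onDegree : ℕ → (Monomial → ℚ) → GradedMonomial → ℚ
onDegree n g (m , d , w) = δ d n (g (m , w))

ev-[v^] : (g : Monomial → ℚ) (n : ℕ) (Z : HV) → ev g ([v^ n ] Z) ≡ ev (onDegree n g) Z
ev-[v^] g n []                  = refl
ev-[v^] g n ((q , m , d , w) ∷ Z) with does (d ℕ.≟ n)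
... | true  = trans (ev-++ g [ (q , m , w) ] ([v^ n ] Z)) (cong₂ _+_ (ℚP.+-identityʳ (q * g (m , w))) (ev-[v^] g n Z))
... | false = trans (ev-[v^] g n Z) (trans (sym (ℚP.+-identityˡ _)) (cong (_+ ev (onDegree n g) Z) (sym (ℚP.*-zeroʳ q))))

[v^]-linear : (n : ℕ) → Linear [v^ n ]_
[v^]-linear n = record { dual = onDegree n ; ev-dual = λ g → ev-[v^] g n }

ev-[v^]-atV : (g : Monomial → ℚ) (n r : ℕ) (h : H) → ev g ([v^ n ] atV r h) ≡ δ r n (ev g h)
ev-[v^]-atV g n r h = trans (ev-[v^] g n (atV r h)) (trans (ev-mapBasis _ (atMonomial r) h) (ev-δ r n g h))

ev-coeffV : (h : ℕ → ℚ) (c : QtV) (n : ℕ) → ev h (coeffV c n) ≡ ev (λ { (m , d) → δ d n (h m) }) c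
ev-coeffV h []              n = refl
ev-coeffV h ((q , m , d) ∷ c) n with does (d ℕ.≟ n)
... | true  = cong (q * h m +_) (ev-coeffV h c n)
... | false = trans (ev-coeffV h c n) (trans (sym (ℚP.+-identityˡ _)) (cong (_+ ev (λ { (m , d) → δ d n (h m) }) c) (sym (ℚP.*-zeroʳ q))))

[v^]-⊙₀ : (n : ℕ) (c : QtV) (h : H) → [v^ n ] (c ⊙₀ h) ≋ scaleQt (coeffV c n) h
[v^]-⊙₀ n c h = mk≋ λ g → begin
  ev g ([v^ n ] (c ⊙ atV 0 h))
    ≡⟨ ev-[v^] g n (c ⊙ atV 0 h) ⟩
  ev (onDegree n g) (c ⊙ atV 0 h)
    ≡⟨ ev-convolve (onDegree n g) shiftTV c (atV 0 h) ⟩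
  ev (λ b → ev (λ x → onDegree n g (shiftTV b x)) (atV 0 h)) c
    ≡⟨ ev-cong c (λ b → ev-mapBasis (λ x → onDegree n g (shiftTV b x)) (atMonomial 0) h) ⟩
  ev (λ { (m , d) → ev (λ { (m′ , w) → δ (d ℕ.+ 0) n (g (m ℕ.+ m′ , w)) }) h }) c
    ≡⟨ ev-cong c (λ { (m , d) → trans (cong (λ d′ → ev (λ { (m′ , w) → δ d′ n (g (m ℕ.+ m′ , w)) }) h) (ℕP.+-identityʳ d))
                                      (ev-δ d n (g ∘ shiftT m) h) }) ⟩
  ev (λ { (m , d) → δ d n (ev (g ∘ shiftT m) h) }) c
    ≡⟨ ev-coeffV (λ m → ev (g ∘ shiftT m) h) c n ⟨
  ev (λ m → ev (g ∘ shiftT m) h) (coeffV c n)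
    ≡⟨ ev-scaleQt g (coeffV c n) h ⟨
  ev g (scaleQt (coeffV c n) h) ∎

ev-coeffV-*Qt : (h : ℕ → ℚ) (c c' : QtV) (j j' : ℕ) →
  ev h (coeffV c j *Qt coeffV c' j') ≡ ev (λ { (m , d) → δ d j (ev (λ { (m′ , d′) → δ d′ j' (h (m ℕ.+ m′)) }) c') }) c
ev-coeffV-*Qt h c c' j j' = begin
  ev h (coeffV c j *Qt coeffV c' j')
    ≡⟨ ev-convolve h ℕ._+_ (coeffV c j) (coeffV c' j') ⟩
  ev (λ m → ev (λ m′ → h (m ℕ.+ m′)) (coeffV c' j')) (coeffV c j)
    ≡⟨ ev-coeffV (λ m → ev (λ m′ → h (m ℕ.+ m′)) (coeffV c' j')) c j ⟩
  ev (λ { (m , d) → δ d j (ev (λ m′ → h (m ℕ.+ m′)) (coeffV c' j')) }) c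
    ≡⟨ ev-cong c (λ { (m , d) → cong (δ d j) (ev-coeffV (λ m′ → h (m ℕ.+ m′)) c' j') }) ⟩
  ev (λ { (m , d) → δ d j (ev (λ { (m′ , d′) → δ d′ j' (h (m ℕ.+ m′)) }) c') }) c ∎

coeffV-*V : (c c' : QtV) (n : ℕ) → coeffV (c *V c') n ≋ ⨁ (suc n) (λ j → coeffV c j *Qt coeffV c' (n ∸ j))
coeffV-*V c c' n = mk≋ λ h → begin
  ev h (coeffV (c *V c') n)
    ≡⟨ ev-coeffV h (c *V c') n ⟩
  ev (λ { (m , d) → δ d n (h m) }) (c *V c')
    ≡⟨ ev-convolve (λ { (m , d) → δ d n (h m) }) addTV c c' ⟩
  ev (λ { (m , d) → ev (λ { (m′ , d′) → δ (d ℕ.+ d′) n (h (m ℕ.+ m′)) }) c' }) c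
    ≡⟨ ev-cong c (λ { (m , d) → ev-cong c' (λ { (m′ , d′) → sym (∑-δ-convolution n d d′ (h (m ℕ.+ m′))) }) }) ⟩
  ev (λ { (m , d) → ev (λ { (m′ , d′) → ∑ (suc n) (λ j → δ d j (δ d′ (n ∸ j) (h (m ℕ.+ m′)))) }) c' }) c
    ≡⟨ ev-cong c (λ { (m , d) → trans (ev-∑ (suc n) (λ j → λ { (m′ , d′) → δ d j (δ d′ (n ∸ j) (h (m ℕ.+ m′))) }) c')
                                      (∑-cong (suc n) (λ j → ev-δ d j (λ { (m′ , d′) → δ d′ (n ∸ j) (h (m ℕ.+ m′)) }) c')) }) ⟩
  ev (λ { (m , d) → ∑ (suc n) (λ j → δ d j (ev (λ { (m′ , d′) → δ d′ (n ∸ j) (h (m ℕ.+ m′)) }) c')) }) c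
    ≡⟨ ev-∑ (suc n) (λ j → λ { (m , d) → δ d j (ev (λ { (m′ , d′) → δ d′ (n ∸ j) (h (m ℕ.+ m′)) }) c') }) c ⟩
  ∑ (suc n) (λ j → ev (λ { (m , d) → δ d j (ev (λ { (m′ , d′) → δ d′ (n ∸ j) (h (m ℕ.+ m′)) }) c') }) c)
    ≡⟨ ∑-cong (suc n) (λ j → ev-coeffV-*Qt h c c' j (n ∸ j)) ⟨
  ∑ (suc n) (λ j → ev h (coeffV c j *Qt coeffV c' (n ∸ j)))
    ≡⟨ ev-⨁ h (suc n) (λ j → coeffV c j *Qt coeffV c' (n ∸ j)) ⟨
  ev h (⨁ (suc n) (λ j → coeffV c j *Qt coeffV c' (n ∸ j))) ∎

coeffFunctional : ℕ → Word → Monomial → ℚ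
coeffFunctional m w (d , u) = if does (d ℕ.≟ m) ∧ does (u ≟W w) then 1ℚ else 0ℚ

coeff-ev : (p : H) (m : ℕ) (w : Word) → coeff p m w ≡ ev (coeffFunctional m w) p
coeff-ev []                m w = refl
coeff-ev ((q , d , u) ∷ p) m w with does (d ℕ.≟ m) ∧ does (u ≟W w)
... | true  = trans (cong (q +_) (coeff-ev p m w)) (cong (_+ ev (coeffFunctional m w) p) (sym (ℚP.*-identityʳ q)))
... | false = trans (coeff-ev p m w) (trans (sym (ℚP.+-identityˡ _)) (cong (_+ ev (coeffFunctional m w) p) (sym (ℚP.*-zeroʳ q))))

≋⇒≈H : {p r : H} → p ≋ r → p ≈H r
≋⇒≈H {p} {r} p≋r m w = trans (coeff-ev p m w) (trans (ev-≡ p≋r (coeffFunctional m w)) (sym (coeff-ev r m w)))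

-- The u^k coefficients of both sides, for a = a' + 1

module Series (a' : ℕ) where

  a : ℕ
  a = suc a'

  zᵃ xᵃ : ℕ → Word
  zᵃ i = z (a ℕ.* suc i)
  xᵃ i = replicate (a ℕ.* suc i) X

  unitAt : ℕ → HV
  unitAt zero    = atV 0 oneH
  unitAt (suc k) = []

  -- The recursion satisfied by the u^k coefficient of both sides.
  recurrence : (ℕ → HV) → ℕ → HV
  recurrence F k =
    unitAt k ++
    ⨁ k (λ i → vV ⊙ prefixV (zᵃ i) (F (k ∸ suc i))) ++
    ⨁ (k ∸ 1) (λ i → tvV ⊙ prefixV (xᵃ i) (F (k ∸ suc i)))

  recurrence-cong : (F G : ℕ → HV) (k : ℕ) → (∀ j → j < k → F j ≋ G j) → recurrence F k ≋ recurrence G k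
  recurrence-cong F G k F≋G = ++-cong (≋-refl {p = unitAt k}) (++-cong
    (⨁-cong< k (λ i i<k → linear-cong (⊙-linear vV) (linear-cong (prefixV-linear (zᵃ i)) (F≋G (k ∸ suc i) (k∸suc<k i<k)))))
    (⨁-cong< (k ∸ 1) (λ i i<k-1 → linear-cong (⊙-linear tvV) (linear-cong (prefixV-linear (xᵃ i))
      (F≋G (k ∸ suc i) (k∸suc<k (ℕP.<-≤-trans i<k-1 (ℕP.m∸n≤m k 1))))))))
    where
    k∸suc<k : {i : ℕ} → i < k → k ∸ suc i < k
    k∸suc<k i<k = ℕP.∸-monoʳ-< (s≤s z≤n) i<k

  recurrence-unique : (F G : ℕ → HV) → (∀ k → F k ≋ recurrence F k) → (∀ k → G k ≋ recurrence G k) →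
    ∀ k → F k ≋ G k
  recurrence-unique F G F-rec G-rec = <-rec (λ k → F k ≋ G k) λ k F≋G<k →
    ≋-trans (F-rec k) (≋-trans (recurrence-cong F G k (λ j j<k → F≋G<k j<k)) (≋-sym (G-rec k)))

  SN : Qt → ℕ → ℕ → H
  SN s k r = Sₛ s (N a k r)

  Sₛ-prefix-zᵃ-N : (s : Qt) (i j r : ℕ) → 0 < j →
    Sₛ s (prefix (zᵃ i) (N a j r)) ≋ prefix (zᵃ i) (SN s j r) ++ scaleQt s (prefix (xᵃ i) (SN s j r))
  Sₛ-prefix-zᵃ-N s i (suc j) r _ =
    ≋-trans (Sₛ-prefix s (zᵃ i) (N a (suc j) r) (NonEmptyWords-N a' j r)) (σ-z-· s (i ℕ.+ a' ℕ.* suc i) (SN s (suc j) r))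

  Sₛ-prefix-zᵃ-N₀ : (s : Qt) (i r : ℕ) → Sₛ s (prefix (zᵃ i) (N a 0 r)) ≋ prefix (zᵃ i) (SN s 0 r)
  Sₛ-prefix-zᵃ-N₀ s i (suc r) = ≋-refl
  Sₛ-prefix-zᵃ-N₀ s i zero    =
    ≋-trans (Sₛ-singleton s (zᵃ i ++ []))
    (≋-trans (≡⇒≋ (cong (Sw s) (LP.++-identityʳ (zᵃ i))))
    (≋-trans (Sw-z s (i ℕ.+ a' ℕ.* suc i)) (≡⇒≋ (cong wordH (sym (LP.++-identityʳ (zᵃ i)))))))

  SN-suc : (s : Qt) (k r : ℕ) → SN s k (suc r) ≋
    ⨁ k (λ i → prefix (zᵃ i) (SN s (k ∸ suc i) r)) ++
    ⨁ (k ∸ 1) (λ i → scaleQt s (prefix (xᵃ i) (SN s (k ∸ suc i) r)))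
  SN-suc s zero    r = ≋-refl
  SN-suc s (suc k) r = begin≋
    SN s (suc k) (suc r)                                    ≡⟨ cong (Sₛ s) (N-suc a (suc k) r) ⟩≋
    Sₛ s (⨁ (suc k) (λ i → prefix (zᵃ i) (N a (k ∸ i) r)))   ≋⟨ linear-⨁ (Sₛ-linear s) (suc k) (λ i → prefix (zᵃ i) (N a (k ∸ i) r)) ⟩
    ⨁ (suc k) (λ i → Sₛ s (prefix (zᵃ i) (N a (k ∸ i) r)))   ≋⟨ ⨁-snoc k (λ i → Sₛ s (prefix (zᵃ i) (N a (k ∸ i) r))) ⟩
    ⨁ k (λ i → Sₛ s (prefix (zᵃ i) (N a (k ∸ i) r))) ++ Sₛ s (prefix (zᵃ k) (N a (k ∸ k) r))
      ≋⟨ ++-cong (⨁-cong< k (λ i i<k → Sₛ-prefix-zᵃ-N s i (k ∸ i) r (ℕP.m<n⇒0<n∸m i<k)))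
                 (≡-subst (λ j → Sₛ s (prefix (zᵃ k) (N a j r)) ≋ prefix (zᵃ k) (SN s j r)) (sym (ℕP.n∸n≡0 k)) (Sₛ-prefix-zᵃ-N₀ s k r)) ⟩
    ⨁ k (λ i → f i ++ g i) ++ f k                           ≋⟨ ++-cong (⨁-++ k f g) ≋-refl ⟩
    (⨁ k f ++ ⨁ k g) ++ f k                                 ≋⟨ ++-swapʳ-≋ (⨁ k f) (⨁ k g) (f k) ⟩
    (⨁ k f ++ f k) ++ ⨁ k g                                 ≋⟨ ++-cong (≋-sym (⨁-snoc k f)) ≋-refl ⟩
    ⨁ (suc k) f ++ ⨁ k g                                    ∎≋
    where
    open ≋-Reasoning
    f g : ℕ → H
    f i = prefix (zᵃ i) (SN s (k ∸ i) r)
    g i = scaleQt s (prefix (xᵃ i) (SN s (k ∸ i) r))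

  -- Σ_r v^r S_t(N_{k,r}), the u^k coefficient of S_t(F(u,v))
  Q : ℕ → HV
  Q k = ⨁ (suc k) (λ r → atV r (SN tQ k r))

  Q-vanishing-tail : (k K : ℕ) → k ≤ K → ⨁ (suc K) (λ r → atV r (SN tQ k r)) ≋ Q k
  Q-vanishing-tail k K k≤K = ⨁-vanishing-tail (suc k) (suc K) _ (s≤s k≤K)
    (λ r k<r → linear-cong (atV-linear r) (≡⇒≋ (cong (Sₛ tQ) (N-empty a k r k<r))))

  Q-recurrence : (k : ℕ) → Q k ≋ recurrence Q k
  Q-recurrence zero    = ≋-refl
  Q-recurrence (suc k) = begin≋
    ⨁ (suc k) (λ r → atV (suc r) (SN tQ (suc k) (suc r)))
      ≋⟨ ⨁-cong (suc k) atV-SN-suc ⟩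
    ⨁ (suc k) (λ r → ⨁ (suc k) (A r) ++ ⨁ k (B r))
      ≋⟨ ⨁-++ (suc k) (λ r → ⨁ (suc k) (A r)) (λ r → ⨁ k (B r)) ⟩
    ⨁ (suc k) (λ r → ⨁ (suc k) (A r)) ++ ⨁ (suc k) (λ r → ⨁ k (B r))
      ≋⟨ ++-cong (⨁-comm (suc k) (suc k) A) (⨁-comm (suc k) k B) ⟩
    ⨁ (suc k) (λ i → ⨁ (suc k) (λ r → A r i)) ++ ⨁ k (λ i → ⨁ (suc k) (λ r → B r i))
      ≋⟨ ++-cong (⨁-cong (suc k) (collect vV zᵃ)) (⨁-cong k (collect tvV xᵃ)) ⟩
    ⨁ (suc k) (λ i → vV ⊙ prefixV (zᵃ i) (Q (k ∸ i))) ++ ⨁ k (λ i → tvV ⊙ prefixV (xᵃ i) (Q (k ∸ i))) ∎≋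
    where
    open ≋-Reasoning
    A B : ℕ → ℕ → HV
    A r i = vV ⊙ prefixV (zᵃ i) (atV r (SN tQ (k ∸ i) r))
    B r i = tvV ⊙ prefixV (xᵃ i) (atV r (SN tQ (k ∸ i) r))
    atV-SN-suc : (r : ℕ) → atV (suc r) (SN tQ (suc k) (suc r)) ≋ ⨁ (suc k) (A r) ++ ⨁ k (B r)
    atV-SN-suc r =
      ≋-trans (linear-cong (atV-linear (suc r)) (SN-suc tQ (suc k) r))
      (≋-trans (linear-++ (atV-linear (suc r)) (⨁ (suc k) zTerms) (⨁ k xTerms))
      (++-cong (≋-trans (linear-⨁ (atV-linear (suc r)) (suc k) zTerms)
                        (⨁-cong (suc k) (λ i → atV-suc-prefix r (zᵃ i) (SN tQ (k ∸ i) r))))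
               (≋-trans (linear-⨁ (atV-linear (suc r)) k xTerms)
                        (⨁-cong k (λ i → atV-suc-t-prefix r (xᵃ i) (SN tQ (k ∸ i) r))))))
      where
      zTerms xTerms : ℕ → H
      zTerms i = prefix (zᵃ i) (SN tQ (k ∸ i) r)
      xTerms i = scaleQt tQ (prefix (xᵃ i) (SN tQ (k ∸ i) r))
    collect : (c : QtV) (w : ℕ → Word) (i : ℕ) →
      ⨁ (suc k) (λ r → c ⊙ prefixV (w i) (atV r (SN tQ (k ∸ i) r))) ≋ c ⊙ prefixV (w i) (Q (k ∸ i))
    collect c w i = ≋-trans (⨁-⊙-prefixV (suc k) c (w i) (λ r → atV r (SN tQ (k ∸ i) r)))
      (linear-cong (⊙-linear c) (linear-cong (prefixV-linear (w i)) (Q-vanishing-tail (k ∸ i) k (ℕP.m∸n≤m k i))))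

  zᵃ-0 : z a ≡ zᵃ 0
  zᵃ-0 = cong (z ∘ suc) (sym (ℕP.*-identityʳ a'))

  xᵃ-0 : replicate a X ≡ xᵃ 0
  xᵃ-0 = cong (λ n → replicate n X) (sym (ℕP.*-identityʳ a))

  xᵃ-++-zᵃ : (i m : ℕ) → xᵃ i ++ zᵃ m ≡ zᵃ (suc (i ℕ.+ m))
  xᵃ-++-zᵃ i m = trans (replicate-X-++-z (a ℕ.* suc i) (m ℕ.+ a' ℕ.* suc m)) (cong z (begin
    suc (a ℕ.* suc i ℕ.+ (m ℕ.+ a' ℕ.* suc m))   ≡⟨ ℕP.+-suc (a ℕ.* suc i) (m ℕ.+ a' ℕ.* suc m) ⟨
    a ℕ.* suc i ℕ.+ a ℕ.* suc m                  ≡⟨ ℕP.*-distribˡ-+ a (suc i) (suc m) ⟨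
    a ℕ.* (suc i ℕ.+ suc m)                      ≡⟨ cong (λ n → a ℕ.* suc n) (ℕP.+-suc i m) ⟩
    a ℕ.* suc (suc (i ℕ.+ m))                    ∎))

  zᵃ-pow : ℕ → Word
  zᵃ-pow zero    = []
  zᵃ-pow (suc i) = z a ++ zᵃ-pow i

  E-word : (i : ℕ) → E a i ≋ wordH (zᵃ-pow i)
  E-word zero    = ≋-refl
  E-word (suc i) = ≋-trans (·-congʳ (wordH (z a)) (E-word i)) (wordH-· (z a) (wordH (zᵃ-pow i)))

  Hs-word : (l : ℕ) → Hs a l ≋ Sₛ oneQ (wordH (zᵃ-pow l))
  Hs-word l = linear-cong (Sₛ-linear oneQ) (E-word l)

  -- From S(z_a w) = z_a S(w) + x^a S(w).
  Hs-suc : (l : ℕ) → Hs a (suc l) ≋ ⨁ (suc l) (λ m → prefix (zᵃ m) (Hs a (l ∸ m)))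
  Hs-suc zero = begin≋
    Hs a 1                          ≋⟨ Hs-word 1 ⟩
    Sₛ oneQ (wordH (z a ++ []))      ≋⟨ Sₛ-singleton oneQ (z a ++ []) ⟩
    Sw oneQ (z a ++ [])              ≡⟨ cong (Sw oneQ) (LP.++-identityʳ (z a)) ⟩≋
    Sw oneQ (z a)                    ≋⟨ Sw-z oneQ a' ⟩
    wordH (z a)                      ≡⟨ cong wordH (trans zᵃ-0 (sym (LP.++-identityʳ (zᵃ 0)))) ⟩≋
    wordH (zᵃ 0 ++ [])               ∎≋
    where open ≋-Reasoning
  Hs-suc (suc l) = begin≋
    Hs a (suc (suc l))
      ≋⟨ Hs-word (suc (suc l)) ⟩
    Sₛ oneQ (prefix (z a) (wordH (zᵃ-pow (suc l))))
      ≋⟨ Sₛ-prefix oneQ (z a) (wordH (zᵃ-pow (suc l))) (NonEmptyWords-prefix-z a' (wordH (zᵃ-pow l))) ⟩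
    σ oneQ (z a) · S′
      ≋⟨ σ-z-· oneQ a' S′ ⟩
    prefix (z a) S′ ++ scaleQt oneQ (prefix (replicate a X) S′)
      ≋⟨ ++-cong (≋-trans (linear-cong (prefix-linear (z a)) (≋-sym (Hs-word (suc l)))) (prefix-≡ zᵃ-0 (Hs a (suc l))))
                 (≋-trans (scaleQt-oneQ _) (≋-trans (prefix-≡ xᵃ-0 S′)
                          (linear-cong (prefix-linear (xᵃ 0)) (≋-trans (≋-sym (Hs-word (suc l))) (Hs-suc l))))) ⟩
    prefix (zᵃ 0) (Hs a (suc l)) ++ prefix (xᵃ 0) (⨁ (suc l) (λ m → prefix (zᵃ m) (Hs a (l ∸ m))))
      ≋⟨ ++-cong ≋-refl (≋-trans (linear-⨁ (prefix-linear (xᵃ 0)) (suc l) (λ m → prefix (zᵃ m) (Hs a (l ∸ m))))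
                                 (⨁-cong (suc l) (λ m → ≋-trans (prefix-prefix (xᵃ 0) (zᵃ m) (Hs a (l ∸ m)))
                                                                (prefix-≡ (xᵃ-++-zᵃ 0 m) (Hs a (l ∸ m)))))) ⟩
    ⨁ (suc (suc l)) (λ m → prefix (zᵃ m) (Hs a (suc l ∸ m))) ∎≋
    where
    open ≋-Reasoning
    S′ = Sₛ oneQ (wordH (zᵃ-pow (suc l)))

  E-suc : (i : ℕ) → E a (suc i) ≋ prefix (z a) (E a i)
  E-suc i = wordH-· (z a) (E a i)

  z-a+zᵃ : (m : ℕ) → z (a ℕ.+ a ℕ.* suc m) ≡ zᵃ (suc m)
  z-a+zᵃ m = cong z (sym (ℕP.*-suc a (suc m)))

  W : ℕ → ℕ → H
  W i l = E a i ∗ Hs a l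

  -- The four parts of z_a^i ∗ S(z_a^l), according to which factor supplies the leading z.
  W-unit W-headE W-headH W-headBoth : ℕ → ℕ → H
  W-unit zero    zero    = oneH
  W-unit zero    (suc l) = []
  W-unit (suc i) l       = []
  W-headE zero    l = []
  W-headE (suc i) l = prefix (zᵃ 0) (W i l)
  W-headH i l = ⨁ l (λ m → prefix (zᵃ m) (W i (l ∸ suc m)))
  W-headBoth zero    l = []
  W-headBoth (suc i) l = ⨁ l (λ m → prefix (zᵃ (suc m)) (W i (l ∸ suc m)))

  W-split : (i l : ℕ) → W i l ≋ W-unit i l ++ W-headE i l ++ W-headH i l ++ W-headBoth i l
  W-split zero zero = oneH-∗-oneH
  W-split zero (suc l) = begin≋
    oneH ∗ Hs a (suc l)                                                 ≋⟨ ∗-congʳ oneH (Hs-suc l) ⟩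
    oneH ∗ ⨁ (suc l) (λ m → prefix (zᵃ m) (Hs a (l ∸ m)))
      ≋⟨ linear-⨁ (∗-linearʳ oneH) (suc l) (λ m → prefix (zᵃ m) (Hs a (l ∸ m))) ⟩
    ⨁ (suc l) (λ m → oneH ∗ prefix (zᵃ m) (Hs a (l ∸ m)))
      ≋⟨ ⨁-cong (suc l) (λ m → oneH-∗-prefix (m ℕ.+ a' ℕ.* suc m) (Hs a (l ∸ m))) ⟩
    W-headH 0 (suc l)                                                   ≋⟨ ≋-sym (++-identityʳ-≋ (W-headH 0 (suc l))) ⟩
    W-headH 0 (suc l) ++ []                                             ∎≋
    where open ≋-Reasoning
  W-split (suc i) zero = begin≋
    E a (suc i) ∗ oneH                      ≋⟨ ∗-congˡ oneH (E-suc i) ⟩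
    prefix (z a) (E a i) ∗ oneH             ≋⟨ prefix-∗-oneH a' (E a i) ⟩
    prefix (z a) (W i 0)                    ≋⟨ prefix-≡ zᵃ-0 (W i 0) ⟩
    W-headE (suc i) 0                       ≋⟨ ≋-sym (++-identityʳ-≋ (W-headE (suc i) 0)) ⟩
    W-headE (suc i) 0 ++ []                 ∎≋
    where open ≋-Reasoning
  W-split (suc i) (suc l) = begin≋
    E a (suc i) ∗ Hs a (suc l)
      ≋⟨ ≋-trans (∗-congˡ (Hs a (suc l)) (E-suc i)) (∗-congʳ (prefix (z a) p) (Hs-suc l)) ⟩
    prefix (z a) p ∗ ⨁ (suc l) (λ m → prefix (zᵃ m) (S m))
      ≋⟨ linear-⨁ (∗-linearʳ (prefix (z a) p)) (suc l) (λ m → prefix (zᵃ m) (S m)) ⟩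
    ⨁ (suc l) (λ m → prefix (z a) p ∗ prefix (zᵃ m) (S m))
      ≋⟨ ⨁-cong (suc l) (λ m → prefix-∗-prefix a' (m ℕ.+ a' ℕ.* suc m) p (S m)) ⟩
    ⨁ (suc l) (λ m → f₁ m ++ f₂ m ++ f₃ m)
      ≋⟨ ≋-trans (⨁-++ (suc l) f₁ (λ m → f₂ m ++ f₃ m)) (++-congʳ (⨁ (suc l) f₁) (⨁-++ (suc l) f₂ f₃)) ⟩
    ⨁ (suc l) f₁ ++ ⨁ (suc l) f₂ ++ ⨁ (suc l) f₃
      ≋⟨ ++-cong headE (++-cong headH headBoth) ⟩
    W-headE (suc i) (suc l) ++ W-headH (suc i) (suc l) ++ W-headBoth (suc i) (suc l) ∎≋
    where
    open ≋-Reasoning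
    p = E a i
    S : ℕ → H
    S m = Hs a (l ∸ m)
    f₁ f₂ f₃ : ℕ → H
    f₁ m = prefix (z a) (p ∗ prefix (zᵃ m) (S m))
    f₂ m = prefix (zᵃ m) (prefix (z a) p ∗ S m)
    f₃ m = prefix (z (a ℕ.+ a ℕ.* suc m)) (p ∗ S m)
    headE : ⨁ (suc l) f₁ ≋ W-headE (suc i) (suc l)
    headE =
      ≋-trans (≋-sym (linear-⨁ (prefix-linear (z a)) (suc l) (λ m → p ∗ prefix (zᵃ m) (S m))))
      (≋-trans (prefix-≡ zᵃ-0 (⨁ (suc l) (λ m → p ∗ prefix (zᵃ m) (S m))))
      (linear-cong (prefix-linear (zᵃ 0))
        (≋-trans (≋-sym (linear-⨁ (∗-linearʳ p) (suc l) (λ m → prefix (zᵃ m) (S m)))) (∗-congʳ p (≋-sym (Hs-suc l))))))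
    headH : ⨁ (suc l) f₂ ≋ W-headH (suc i) (suc l)
    headH = ⨁-cong (suc l) (λ m → linear-cong (prefix-linear (zᵃ m)) (∗-congˡ (S m) (≋-sym (E-suc i))))
    headBoth : ⨁ (suc l) f₃ ≋ W-headBoth (suc i) (suc l)
    headBoth = ⨁-cong (suc l) (λ m → prefix-≡ (z-a+zᵃ m) (p ∗ S m))

  G : ℕ → ℕ → HV
  G i l = c^ i l ⊙₀ W i l

  -- Σ_i c₁^i c₂^{k-i} (z_a^i ∗ S(z_a^{k-i})), the u^k coefficient of E(c₁u) ∗ H(c₂u)
  P : ℕ → HV
  P k = ⨁ (suc k) (λ i → G i (k ∸ i))

  -- Both sides are Σ_{i + m < K} c₂^{m+1} c₁^i c₂^{K-i-m-1} u_m (z_a^i ∗ S(z_a^{K-i-m-1})).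
  regroup : (K : ℕ) (e : QtV) (u : ℕ → Word) →
    ⨁ (suc K) (λ i → ⨁ (K ∸ i) (λ m → (e *V c^ i (K ∸ i)) ⊙ prefixV (u m) (atV 0 (W i (K ∸ i ∸ suc m))))) ≋
    ⨁ K (λ m → (e *V powV c₂ (suc m)) ⊙ prefixV (u m) (P (K ∸ suc m)))
  regroup K e u = begin≋
    ⨁ (suc K) (λ i → ⨁ (K ∸ i) (λ m → T i m))           ≋⟨ ⨁-triangle-comm (suc K) T ⟩
    ⨁ (suc K) (λ m → ⨁ (K ∸ m) (λ i → T i m))           ≋⟨ ⨁-snoc K (λ m → ⨁ (K ∸ m) (λ i → T i m)) ⟩
    ⨁ K (λ m → ⨁ (K ∸ m) (λ i → T i m)) ++ ⨁ (K ∸ K) (λ i → T i K)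
      ≡⟨ cong (λ j → ⨁ K (λ m → ⨁ (K ∸ m) (λ i → T i m)) ++ ⨁ j (λ i → T i K)) (ℕP.n∸n≡0 K) ⟩≋
    ⨁ K (λ m → ⨁ (K ∸ m) (λ i → T i m)) ++ []            ≋⟨ ++-identityʳ-≋ _ ⟩
    ⨁ K (λ m → ⨁ (K ∸ m) (λ i → T i m))                 ≋⟨ ⨁-cong< K column ⟩
    ⨁ K (λ m → (e *V powV c₂ (suc m)) ⊙ prefixV (u m) (P (K ∸ suc m))) ∎≋
    where
    open ≋-Reasoning
    T : ℕ → ℕ → HV
    T i m = (e *V c^ i (K ∸ i)) ⊙ prefixV (u m) (atV 0 (W i (K ∸ i ∸ suc m)))
    term : (m i : ℕ) → suc m ℕ.+ i ≤ K →
      T i m ≋ (e *V powV c₂ (suc m)) ⊙ prefixV (u m) (G i (K ∸ suc m ∸ i))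
    term m i m+i<K = begin≋
      (e *V c^ i (K ∸ i)) ⊙ prefixV (u m) (atV 0 (W i (K ∸ i ∸ suc m)))
        ≡⟨ cong₂ (λ l l' → (e *V c^ i l) ⊙ prefixV (u m) (atV 0 (W i l')))
                 (∸-split K (suc m) i m+i<K) (∸-comm K i (suc m)) ⟩≋
      (e *V c^ i (suc m ℕ.+ r)) ⊙ prefixV (u m) (atV 0 (W i r))
        ≋⟨ ⊙-congˡ (prefixV (u m) (atV 0 (W i r))) (c^-shift e i m r) ⟩
      ((e *V powV c₂ (suc m)) *V c^ i r) ⊙ prefixV (u m) (atV 0 (W i r))
        ≋⟨ *V-⊙ (e *V powV c₂ (suc m)) (c^ i r) (prefixV (u m) (atV 0 (W i r))) ⟩
      (e *V powV c₂ (suc m)) ⊙ (c^ i r ⊙ prefixV (u m) (atV 0 (W i r)))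
        ≋⟨ linear-cong (⊙-linear (e *V powV c₂ (suc m))) (⊙-prefixV (c^ i r) (u m) (atV 0 (W i r))) ⟩
      (e *V powV c₂ (suc m)) ⊙ prefixV (u m) (G i r) ∎≋
      where r = K ∸ suc m ∸ i
    column : (m : ℕ) → m < K →
      ⨁ (K ∸ m) (λ i → T i m) ≋ (e *V powV c₂ (suc m)) ⊙ prefixV (u m) (P (K ∸ suc m))
    column m m<K rewrite ℕP.+-∸-assoc 1 m<K =
      ≋-trans (⨁-cong< (suc j) (λ i i≤j → term m i (ℕP.≤-trans (ℕP.+-monoʳ-≤ (suc m) (ℕP.≤-pred i≤j)) (ℕP.≤-reflexive (ℕP.m+[n∸m]≡n m<K)))))
              (⨁-⊙-prefixV (suc j) (e *V powV c₂ (suc m)) (u m) (λ i → G i (j ∸ i)))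
      where j = K ∸ suc m

  P-split : (k : ℕ) → P k ≋
    ⨁ (suc k) (λ i → c^ i (k ∸ i) ⊙₀ W-unit i (k ∸ i)) ++
    ⨁ (suc k) (λ i → c^ i (k ∸ i) ⊙₀ W-headE i (k ∸ i)) ++
    ⨁ (suc k) (λ i → c^ i (k ∸ i) ⊙₀ W-headH i (k ∸ i)) ++
    ⨁ (suc k) (λ i → c^ i (k ∸ i) ⊙₀ W-headBoth i (k ∸ i))
  P-split k =
    ≋-trans (⨁-cong (suc k) (λ i → ≋-trans (linear-cong (⊙₀-linear (c i)) (W-split i (k ∸ i))) (split4 i)))
    (≋-trans (⨁-++ (suc k) Pu (λ i → Pe i ++ Ph i ++ Pb i))
    (++-congʳ (⨁ (suc k) Pu) (≋-trans (⨁-++ (suc k) Pe (λ i → Ph i ++ Pb i))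
    (++-congʳ (⨁ (suc k) Pe) (⨁-++ (suc k) Ph Pb)))))
    where
    c : ℕ → QtV
    c i = c^ i (k ∸ i)
    Pu Pe Ph Pb : ℕ → HV
    Pu i = c i ⊙₀ W-unit i (k ∸ i)
    Pe i = c i ⊙₀ W-headE i (k ∸ i)
    Ph i = c i ⊙₀ W-headH i (k ∸ i)
    Pb i = c i ⊙₀ W-headBoth i (k ∸ i)
    split4 : (i : ℕ) → c i ⊙₀ (W-unit i (k ∸ i) ++ W-headE i (k ∸ i) ++ W-headH i (k ∸ i) ++ W-headBoth i (k ∸ i)) ≋
                       Pu i ++ Pe i ++ Ph i ++ Pb i
    split4 i = ≋-trans (linear-++ L (W-unit i (k ∸ i)) _)
               (++-congʳ (Pu i) (≋-trans (linear-++ L (W-headE i (k ∸ i)) _)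
               (++-congʳ (Pe i) (linear-++ L (W-headH i (k ∸ i)) (W-headBoth i (k ∸ i))))))
      where L = ⊙₀-linear (c i)

  ⊙₀-[] : (c : QtV) → c ⊙₀ [] ≋ []
  ⊙₀-[] c = ⊙-[] c

  P-unit : (k : ℕ) → ⨁ (suc k) (λ i → c^ i (k ∸ i) ⊙₀ W-unit i (k ∸ i)) ≋ unitAt k
  P-unit zero    = ≋-trans (++-identityʳ-≋ _) (≋-trans (⊙-congˡ (atV 0 oneH) (oneV-*V oneV)) (oneV-⊙ (atV 0 oneH)))
  P-unit (suc k) = ⨁-vanishing (suc (suc k)) _ vanish
    where
    vanish : (i : ℕ) → c^ i (suc k ∸ i) ⊙₀ W-unit i (suc k ∸ i) ≋ []
    vanish zero    = ⊙₀-[] (c^ 0 (suc k))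
    vanish (suc i) = ⊙₀-[] (c^ (suc i) (k ∸ i))

  P-headE : (k : ℕ) → ⨁ (suc (suc k)) (λ i → c^ i (suc k ∸ i) ⊙₀ W-headE i (suc k ∸ i)) ≋ c₁ ⊙ prefixV (zᵃ 0) (P k)
  P-headE k =
    ≋-trans (++-cong (⊙₀-[] (c^ 0 (suc k))) (⨁-cong (suc k) term))
            (⨁-⊙-prefixV (suc k) c₁ (zᵃ 0) (λ i → G i (k ∸ i)))
    where
    term : (i : ℕ) → c^ (suc i) (k ∸ i) ⊙₀ prefix (zᵃ 0) (W i (k ∸ i)) ≋ c₁ ⊙ prefixV (zᵃ 0) (G i (k ∸ i))
    term i = ≋-trans (⊙₀-prefix (c^ (suc i) (k ∸ i)) (zᵃ 0) (W i (k ∸ i)))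
      (≋-trans (⊙-congˡ _ (c^-suc i (k ∸ i)))
      (≋-trans (*V-⊙ c₁ (c^ i (k ∸ i)) _)
               (linear-cong (⊙-linear c₁) (⊙-prefixV (c^ i (k ∸ i)) (zᵃ 0) (atV 0 (W i (k ∸ i)))))))

  P-headH : (k : ℕ) → ⨁ (suc k) (λ i → c^ i (k ∸ i) ⊙₀ W-headH i (k ∸ i)) ≋
    ⨁ k (λ m → powV c₂ (suc m) ⊙ prefixV (zᵃ m) (P (k ∸ suc m)))
  P-headH k =
    ≋-trans (⨁-cong (suc k) (λ i → ≋-trans (⊙₀-⨁-prefix (c^ i (k ∸ i)) (k ∸ i) zᵃ (λ m → W i (k ∸ i ∸ suc m)))
                                            (⨁-cong (k ∸ i) (λ m → ⊙-congˡ _ (≋-sym (oneV-*V (c^ i (k ∸ i))))))))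
    (≋-trans (regroup k oneV zᵃ)
             (⨁-cong k (λ m → ⊙-congˡ (prefixV (zᵃ m) (P (k ∸ suc m))) (oneV-*V (powV c₂ (suc m))))))

  P-headBoth : (k : ℕ) → ⨁ (suc (suc k)) (λ i → c^ i (suc k ∸ i) ⊙₀ W-headBoth i (suc k ∸ i)) ≋
    ⨁ k (λ m → (c₁ *V powV c₂ (suc m)) ⊙ prefixV (zᵃ (suc m)) (P (k ∸ suc m)))
  P-headBoth k =
    ≋-trans (++-cong (⊙₀-[] (c^ 0 (suc k)))
                     (⨁-cong (suc k) (λ i → ≋-trans (⊙-congˡ _ (c^-suc i (k ∸ i)))
                                                     (⊙₀-⨁-prefix (c₁ *V c^ i (k ∸ i)) (k ∸ i) (zᵃ ∘ suc) (λ m → W i (k ∸ i ∸ suc m))))))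
            (regroup k c₁ (zᵃ ∘ suc))

  recurrence-c₂ : (ℕ → HV) → ℕ → HV
  recurrence-c₂ F k = unitAt k ++ ⨁ k (λ m → (vV *V powV c₂ m) ⊙ prefixV (zᵃ m) (F (k ∸ suc m)))

  P-recurrence-c₂ : (k : ℕ) → P k ≋ recurrence-c₂ P k
  P-recurrence-c₂ zero =
    ≋-trans (P-split 0) (++-cong (P-unit 0) (++-cong noHead (++-cong (P-headH 0) noHead)))
    where
    noHead : (c^ 0 0 ⊙₀ []) ++ [] ≋ []
    noHead = ≋-trans (++-identityʳ-≋ (c^ 0 0 ⊙₀ [])) (⊙₀-[] (c^ 0 0))
  P-recurrence-c₂ (suc k) = begin≋
    P (suc k)
      ≋⟨ P-split (suc k) ⟩
    _ ≋⟨ ++-cong (P-unit (suc k)) (++-cong (P-headE k) (++-cong (P-headH (suc k)) (P-headBoth k))) ⟩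
    [] ++ B′ ++ C′ ++ D′
      ≋⟨ ++-congʳ B′ (++-comm-≋ C′ D′) ⟩
    B′ ++ D′ ++ C′
      ≋⟨ ≋-sym (++-assoc-≋ B′ D′ C′) ⟩
    (B′ ++ D′) ++ C′
      ≋⟨ ++-congˡ C′ (++-congˡ D′ (⊙-congˡ (zP 0) (≋-sym (*V-oneV c₁)))) ⟩
    ⨁ (suc k) (λ m → (c₁ *V powV c₂ m) ⊙ zP m) ++ C′
      ≋⟨ ≋-sym (⨁-++ (suc k) (λ m → (c₁ *V powV c₂ m) ⊙ zP m) (λ m → powV c₂ (suc m) ⊙ zP m)) ⟩
    ⨁ (suc k) (λ m → (c₁ *V powV c₂ m) ⊙ zP m ++ powV c₂ (suc m) ⊙ zP m)
      ≋⟨ ≋-sym (⨁-cong (suc k) (λ m → v*c₂^-split m (zP m))) ⟩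
    ⨁ (suc k) (λ m → (vV *V powV c₂ m) ⊙ zP m) ∎≋
    where
    open ≋-Reasoning
    zP : ℕ → HV
    zP m = prefixV (zᵃ m) (P (k ∸ m))
    B′ C′ D′ : HV
    B′ = c₁ ⊙ zP 0
    C′ = ⨁ (suc k) (λ m → powV c₂ (suc m) ⊙ zP m)
    D′ = ⨁ k (λ m → (c₁ *V powV c₂ (suc m)) ⊙ zP (suc m))

  tv-xᵃ-zᵃ : (i m : ℕ) (c : QtV) (Z : HV) →
    tvV ⊙ prefixV (xᵃ i) (c ⊙ prefixV (zᵃ m) Z) ≋ (tvV *V c) ⊙ prefixV (zᵃ (suc (i ℕ.+ m))) Z
  tv-xᵃ-zᵃ i m c Z = begin≋
    tvV ⊙ prefixV (xᵃ i) (c ⊙ prefixV (zᵃ m) Z)      ≋⟨ linear-cong (⊙-linear tvV) (≋-sym (⊙-prefixV c (xᵃ i) (prefixV (zᵃ m) Z))) ⟩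
    tvV ⊙ (c ⊙ prefixV (xᵃ i) (prefixV (zᵃ m) Z))
      ≋⟨ linear-cong (⊙-linear tvV) (linear-cong (⊙-linear c)
           (≋-trans (prefixV-prefixV (xᵃ i) (zᵃ m) Z) (prefixV-≡ (xᵃ-++-zᵃ i m) Z))) ⟩
    tvV ⊙ (c ⊙ prefixV (zᵃ (suc (i ℕ.+ m))) Z)        ≋⟨ ≋-sym (*V-⊙ tvV c (prefixV (zᵃ (suc (i ℕ.+ m))) Z)) ⟩
    (tvV *V c) ⊙ prefixV (zᵃ (suc (i ℕ.+ m))) Z       ∎≋
    where open ≋-Reasoning

  tv-xᵃ-recurrence-c₂ : (F : ℕ → HV) → (∀ k → F k ≋ recurrence-c₂ F k) → (i j : ℕ) →
    tvV ⊙ prefixV (xᵃ i) (F (suc j)) ≋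
    ⨁ (suc j) (λ m → (tvV *V (vV *V powV c₂ m)) ⊙ prefixV (zᵃ (suc (i ℕ.+ m))) (F (j ∸ m)))
  tv-xᵃ-recurrence-c₂ F F-rec i j =
    ≋-trans (linear-cong L (F-rec (suc j)))
    (≋-trans (linear-⨁ L (suc j) (λ m → (vV *V powV c₂ m) ⊙ prefixV (zᵃ m) (F (j ∸ m))))
             (⨁-cong (suc j) (λ m → tv-xᵃ-zᵃ i m (vV *V powV c₂ m) (F (j ∸ m)))))
    where L = linear-∘ (⊙-linear tvV) (prefixV-linear (xᵃ i))

  -- Expanding c₂^M = (1 + tv)^M geometrically turns the x-free recursion into `recurrence`.
  recurrence-c₂⇒recurrence : (F : ℕ → HV) → (∀ k → F k ≋ recurrence-c₂ F k) → ∀ k → F k ≋ recurrence F k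
  recurrence-c₂⇒recurrence F F-rec zero    = F-rec 0
  recurrence-c₂⇒recurrence F F-rec (suc k) = begin≋
    F (suc k)
      ≋⟨ F-rec (suc k) ⟩
    [] ++ ⨁ (suc k) (λ m → (vV *V powV c₂ m) ⊙ zF m)
      ≋⟨ ++-cong (⊙-congˡ (zF 0) (*V-oneV vV)) (⨁-cong k (λ s → v*c₂^-geometric s (zF (suc s)))) ⟩
    vV ⊙ zF 0 ++ ⨁ k (λ s → vV ⊙ zF (suc s) ++ T s)
      ≋⟨ ++-congʳ (vV ⊙ zF 0) (⨁-++ k (λ s → vV ⊙ zF (suc s)) T) ⟩
    vV ⊙ zF 0 ++ ⨁ k (λ s → vV ⊙ zF (suc s)) ++ ⨁ k T
      ≋⟨ ≋-sym (++-assoc-≋ (vV ⊙ zF 0) (⨁ k (λ s → vV ⊙ zF (suc s))) (⨁ k T)) ⟩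
    ⨁ (suc k) (λ i → vV ⊙ zF i) ++ ⨁ k T
      ≋⟨ ++-congʳ (⨁ (suc k) (λ i → vV ⊙ zF i)) (≋-sym xTerms) ⟩
    ⨁ (suc k) (λ i → vV ⊙ zF i) ++ ⨁ k (λ i → tvV ⊙ prefixV (xᵃ i) (F (k ∸ i))) ∎≋
    where
    open ≋-Reasoning
    zF : ℕ → HV
    zF m = prefixV (zᵃ m) (F (k ∸ m))
    T : ℕ → HV
    T s = ⨁ (suc s) (λ c → (tvV *V (vV *V powV c₂ (s ∸ c))) ⊙ zF (suc s))
    fT : ℕ → ℕ → HV
    fT i m = (tvV *V (vV *V powV c₂ m)) ⊙ prefixV (zᵃ (suc (i ℕ.+ m))) (F (k ∸ suc i ∸ m))
    reindex : (s c : ℕ) → c ≤ s → prefixV (zᵃ (suc (c ℕ.+ (s ∸ c)))) (F (k ∸ suc c ∸ (s ∸ c))) ≋ zF (suc s)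
    reindex s c c≤s = ≡⇒≋ (cong₂ (λ x y → prefixV (zᵃ (suc x)) (F y)) (ℕP.m+[n∸m]≡n c≤s)
      (trans (ℕP.∸-+-assoc k (suc c) (s ∸ c)) (cong (λ x → k ∸ suc x) (ℕP.m+[n∸m]≡n c≤s))))
    xTerms : ⨁ k (λ i → tvV ⊙ prefixV (xᵃ i) (F (k ∸ i))) ≋ ⨁ k T
    xTerms =
      ≋-trans (⨁-cong< k (λ i i<k → ≡-subst (λ n → tvV ⊙ prefixV (xᵃ i) (F n) ≋ ⨁ n (fT i))
                                             (sym (ℕP.+-∸-assoc 1 i<k)) (tv-xᵃ-recurrence-c₂ F F-rec i (k ∸ suc i))))
      (≋-trans (⨁-triangle-antidiagonal k fT)
               (⨁-cong k (λ s → ⨁-cong< (suc s) (λ c c≤s →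
                 linear-cong (⊙-linear (tvV *V (vV *V powV c₂ (s ∸ c)))) (reindex s c (ℕP.≤-pred c≤s))))))

  Q≋P : (k : ℕ) → Q k ≋ P k
  Q≋P = recurrence-unique Q P Q-recurrence (recurrence-c₂⇒recurrence P P-recurrence-c₂)

  F-≤ : (k n : ℕ) → n ≤ k → F a k n ≡ N a k n
  F-≤ zero    zero    _   = refl
  F-≤ (suc k) zero    _   = refl
  F-≤ (suc k) (suc n) n≤k = cong (λ b → if b then N a (suc k) (suc n) else []) (dec-true (suc n ℕ.≤? suc k) n≤k)

  F-> : (k n : ℕ) → k < n → F a k n ≡ []
  F-> zero    (suc n) _   = refl
  F-> (suc k) (suc n) k<n = cong (λ b → if b then N a (suc k) (suc n) else []) (dec-false (suc n ℕ.≤? suc k) (ℕP.<⇒≱ k<n))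

  lhs-coefficient : (k n : ℕ) → Sₛ tQ (F a k n) ≋ [v^ n ] Q k
  lhs-coefficient k n = mk≋ λ g → sym (begin
    ev g ([v^ n ] Q k)
      ≡⟨ ev-≡ (linear-⨁ ([v^]-linear n) (suc k) (λ r → atV r (SN tQ k r))) g ⟩
    ev g (⨁ (suc k) (λ r → [v^ n ] atV r (SN tQ k r)))
      ≡⟨ ev-⨁ g (suc k) (λ r → [v^ n ] atV r (SN tQ k r)) ⟩
    ∑ (suc k) (λ r → ev g ([v^ n ] atV r (SN tQ k r)))
      ≡⟨ ∑-cong (suc k) (λ r → trans (ev-[v^]-atV g n r (SN tQ k r)) (δ-sym r n _)) ⟩
    ∑ (suc k) (λ r → δ n r (ev g (SN tQ k r)))
      ≡⟨ select g ⟩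
    ev g (Sₛ tQ (F a k n)) ∎)
    where
    select : (g : Monomial → ℚ) → ∑ (suc k) (λ r → δ n r (ev g (SN tQ k r))) ≡ ev g (Sₛ tQ (F a k n))
    select g with n ℕ.≤? k
    ... | yes n≤k = trans (∑-δ (suc k) n (λ r → ev g (SN tQ k r)) (s≤s n≤k)) (cong (ev g ∘ Sₛ tQ) (sym (F-≤ k n n≤k)))
    ... | no n≰k  = trans (∑-δ-out-of-range (suc k) n (λ r → ev g (SN tQ k r)) (ℕP.≰⇒> n≰k))
                          (cong (ev g ∘ Sₛ tQ) (sym (F-> k n (ℕP.≰⇒> n≰k))))

  rhs-coefficient : (k n : ℕ) → (subst (E a) c₁ ∗² subst (Hs a) c₂) k n ≋ [v^ n ] P k
  rhs-coefficient k n = begin≋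
    (subst (E a) c₁ ∗² subst (Hs a) c₂) k n
      ≡⟨ trans (concatMap-applyUpTo (λ i → concatMap (term i) (upTo (suc n))) id (suc k))
               (⨁-cong-≡ (suc k) (λ i → concatMap-applyUpTo (term i) id (suc n))) ⟩≋
    ⨁ (suc k) (λ i → ⨁ (suc n) (λ j → scaleQt (coeffV (x i) j) (E a i) ∗ scaleQt (coeffV (y i) (n ∸ j)) (Hs a (k ∸ i))))
      ≋⟨ ⨁-cong (suc k) (λ i → ⨁-cong (suc n) (λ j → scaleQt-∗-scaleQt (coeffV (x i) j) (coeffV (y i) (n ∸ j)) (E a i) (Hs a (k ∸ i)))) ⟩
    ⨁ (suc k) (λ i → ⨁ (suc n) (λ j → scaleQt (coeffV (x i) j *Qt coeffV (y i) (n ∸ j)) (W i (k ∸ i))))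
      ≋⟨ ⨁-cong (suc k) (λ i → ≋-sym (linear-⨁ (scaleQt-linearˡ (W i (k ∸ i))) (suc n) (λ j → coeffV (x i) j *Qt coeffV (y i) (n ∸ j)))) ⟩
    ⨁ (suc k) (λ i → scaleQt (⨁ (suc n) (λ j → coeffV (x i) j *Qt coeffV (y i) (n ∸ j))) (W i (k ∸ i)))
      ≋⟨ ⨁-cong (suc k) (λ i → ≋-trans (linear-cong (scaleQt-linearˡ (W i (k ∸ i))) (≋-sym (coeffV-*V (x i) (y i) n)))
                                        (≋-sym ([v^]-⊙₀ n (c^ i (k ∸ i)) (W i (k ∸ i))))) ⟩
    ⨁ (suc k) (λ i → [v^ n ] G i (k ∸ i))
      ≋⟨ ≋-sym (linear-⨁ ([v^]-linear n) (suc k) (λ i → G i (k ∸ i))) ⟩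
    [v^ n ] P k ∎≋
    where
    open ≋-Reasoning
    term : ℕ → ℕ → H
    term i j = subst (E a) c₁ i j ∗ subst (Hs a) c₂ (k ∸ i) (n ∸ j)
    x y : ℕ → QtV
    x i = powV c₁ i
    y i = powV c₂ (k ∸ i)

  coefficients-agree : (k n : ℕ) → Sₛ² tQ (F a) k n ≈H (subst (E a) c₁ ∗² subst (Hs a) c₂) k n
  coefficients-agree k n = ≋⇒≈H (≋-trans (lhs-coefficient k n)
                  (≋-trans (linear-cong ([v^]-linear n) (Q≋P k)) (≋-sym (rhs-coefficient k n))))

mainTheorem10 : (a : ℕ) → a ≥ 1 → (k n : ℕ) →
    Sₛ² tQ (F a) k n ≈H (subst (E a) c₁ ∗² subst (Hs a) c₂) k n
mainTheorem10 (suc a') (s≤s z≤n) = Series.coefficients-agree a'
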